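{- Let $\Lambda=(\lambda_1,\dots,\lambda_n)$ with $\lambda_1<\dots<\lambda_n$, let $\mathbf{A}_\Lambda$ be the set of (combinatorial types of) simple arrangements of $n$ lines realizable with the slopes of $\Lambda$, and let $\mathbf{F}_\Lambda$ be the subgraph of the triangle flip graph $\mathbf{F}_n$ induced by $\mathbf{A}_\Lambda$. Then $\mathbf{F}_\Lambda$ is $(n-2)$-connected.
   Context: An arrangement of pseudolines is a finite collection of simple bi-infinite curves in the plane, every two meeting in exactly one crossing point, with no three through a common point; it is marked by a designated unbounded north-cell (for lines, the cell above all lines), and pseudolines are labelled canonically, i.e., in the order met when traversing from the north-cell to the opposite unbounded cell through unbounded cells keeping all vertices on the right. An arrangement of lines is realized with slopes $\Lambda$ if the $i$-th line (in canonical labeling) has slope $\lambda_i$. A triangle flip moves one curve of a triangular bounded cell across the crossing of the other two. $\mathbf{F}_n$ is the graph on isomorphism classes of simple marked arrangements of $n$ pseudolines with edges given by triangle flips. A graph is $r$-connected if it has more than $r$ vertices and stays connected after deleting any fewer than $r$ vertices. -}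

module Defs where

open import Level using (Level; 0ℓ) renaming (suc to lsuc)
open import Data.Nat as ℕ using (ℕ)
open import Data.Bool using (Bool; true; false)
open import Data.Fin using (Fin; _<_)
open import Data.List using (List; length)
open import Data.List.Relation.Unary.Any using (Any)
open import Data.List.Relation.Unary.AllPairs using (AllPairs)
open import Data.List.Relation.Unary.All using (All)
open import Data.Product using (Σ; ∃; _×_; _,_)
open import Relation.Nullary using (¬_)
open import Relation.Binary.PropositionalEquality using (_≡_; _≢_)
open import Relation.Binary.Structures using (IsStrictTotalOrder)
open import Algebra.Structures using (IsCommutativeRing)

-- The real numbers: a Dedekind-complete ordered field (unique up to
-- isomorphism, so quantifying over all such structures = working in ℝ).

record RealNumbers : Set₁ where
  infixl 6 _+_ _-_
  infixl 7 _*_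
  infix 4 _<ℝ_
  field
    ℝ   : Set
    _+_ : ℝ → ℝ → ℝ
    _*_ : ℝ → ℝ → ℝ
    -_  : ℝ → ℝ
    0ℝ  : ℝ
    1ℝ  : ℝ
    _<ℝ_ : ℝ → ℝ → Set
    isCommutativeRing : IsCommutativeRing _≡_ _+_ _*_ -_ 0ℝ 1ℝ
    0≢1     : 0ℝ ≢ 1ℝ
    inverse : ∀ x → x ≢ 0ℝ → Σ ℝ (λ y → x * y ≡ 1ℝ)
    isStrictTotalOrder : IsStrictTotalOrder _≡_ _<ℝ_
    +-mono-< : ∀ {x y} z → x <ℝ y → x + z <ℝ y + z
    *-pos    : ∀ {x y} → 0ℝ <ℝ x → 0ℝ <ℝ y → 0ℝ <ℝ x * y
    lub : (P : ℝ → Set) → Σ ℝ P → Σ ℝ (λ u → ∀ x → P x → ¬ (u <ℝ x)) →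
          Σ ℝ (λ s → (∀ x → P x → ¬ (s <ℝ x)) ×
                     (∀ u → (∀ x → P x → ¬ (u <ℝ x)) → ¬ (u <ℝ s)))

  _-_ : ℝ → ℝ → ℝ
  x - y = x + (- y)

-- Combinatorial types of simple marked arrangements of n pseudolines,
-- encoded (Felsner–Weil) as rank-3 signotopes: a sign for every triple
-- i < j < k (values on non-increasing triples are ignored).



SignAssignment : ℕ → Set
SignAssignment n = Fin n → Fin n → Fin n → Bool

_≈_ : ∀ {n} → SignAssignment n → SignAssignment n → Set
_≈_ {n} χ ψ = ∀ (i j k : Fin n) → i < j → j < k → χ i j k ≡ ψ i j k

changes : Bool → Bool → ℕ
changes true  true  = 0
changes false false = 0
changes _     _     = 1

Monotone4 : Bool → Bool → Bool → Bool → Set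
Monotone4 x₁ x₂ x₃ x₄ = changes x₁ x₂ ℕ.+ changes x₂ x₃ ℕ.+ changes x₃ x₄ ℕ.≤ 1

IsSignotope : ∀ {n} → SignAssignment n → Set
IsSignotope {n} χ = ∀ (a b c d : Fin n) → a < b → b < c → c < d →
  Monotone4 (χ a b c) (χ a b d) (χ a c d) (χ b c d)

Flip : ∀ {n} → SignAssignment n → SignAssignment n → Set
Flip {n} χ ψ = IsSignotope χ × IsSignotope ψ ×
  Σ (Fin n) λ i → Σ (Fin n) λ j → Σ (Fin n) λ k → i < j × j < k ×
    (χ i j k ≢ ψ i j k) ×
    (∀ (i' j' k' : Fin n) → i' < j' → j' < k' → χ i' j' k' ≢ ψ i' j' k' →
       (i' ≡ i) × (j' ≡ j) × (k' ≡ k))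

module _ (R : RealNumbers) where
  open RealNumbers R

  StrictlyIncreasing : ∀ {n} → (Fin n → ℝ) → Set
  StrictlyIncreasing {n} Λ = ∀ (i j : Fin n) → i < j → Λ i <ℝ Λ j

  -- Line i is y = Λ i · x + b i.  For i<j<k (slopes increasing) the
  -- x-coordinate of the crossing of lines p,q is (b p − b q)/(Λ q − Λ p);
  -- the sign of triple ijk records whether the crossing of i,j lies left
  -- of the crossing of j,k (cleared of the positive denominators).
  -- Simplicity (no three lines concurrent) = these never coincide.
  RealizesWith : ∀ {n} → (Fin n → ℝ) → (Fin n → ℝ) → SignAssignment n → Set
  RealizesWith {n} Λ b χ = ∀ (i j k : Fin n) → i < j → j < k →
    ((χ i j k ≡ true  → (b i - b j) * (Λ k - Λ j) <ℝ (b j - b k) * (Λ j - Λ i)) ×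
     (χ i j k ≡ false → (b j - b k) * (Λ j - Λ i) <ℝ (b i - b j) * (Λ k - Λ j)))

  RealizableWithSlopes : ∀ {n} → (Fin n → ℝ) → SignAssignment n → Set
  RealizableWithSlopes {n} Λ χ = Σ (Fin n → ℝ) λ b → RealizesWith Λ b χ

data Reach {n} (P : SignAssignment n → Set) :
     SignAssignment n → SignAssignment n → Set where
  here : ∀ {u v} → u ≈ v → Reach P u v
  step : ∀ {u w v} → Flip u w → P w → Reach P w v → Reach P u v

-- V (closed under ≈ for all realizability predicates above) induces an
-- r-connected subgraph of 𝐅_n: it has more than r vertices and remains
-- connected after deleting any fewer than r vertices.
IsConnectedInduced : ∀ {n} → ℕ → (SignAssignment n → Set) → Set
IsConnectedInduced {n} r V =
  (Σ (List (SignAssignment n)) λ xs →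
     (length xs ≡ ℕ.suc r) × AllPairs (λ χ ψ → ¬ (χ ≈ ψ)) xs ×
     All (λ χ → IsSignotope χ × V χ) xs)
  ×
  (∀ (X : List (SignAssignment n)) → length X ℕ.< r →
     ∀ u v → IsSignotope u → V u → IsSignotope v → V v →
     ¬ Any (u ≈_) X → ¬ Any (v ≈_) X →
     Reach (λ w → IsSignotope w × V w × ¬ Any (w ≈_) X) u v)

module Submission where

-- The intercepts b ∈ ℝⁿ of the lines y = λᵢ x + bᵢ are cut by the hyperplanes Δ · t = 0, one for
-- each triple t = (i < j < k), into chambers, which are the simple arrangements with slopes Λ.
-- Crossing a single hyperplane is a triangle flip, so 𝐅_Λ is the graph of the zonotope
-- Σₜ [- Δ · t , Δ · t], of dimension n - 2 since every Δ · t vanishes on b = α + β Λ.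
-- Connectivity is Balinski's argument for this zonotope: when fewer than n - 2 vertices are
-- deleted, an underdetermined linear system gives a direction q, off the span of 1 and Λ, that
-- puts the deleted vertices and u on one level.  Walking from u and from v straight towards q
-- (from generic points, so that one hyperplane is crossed at a time) raises the q-height strictly
-- up to the face on which q is maximal, where a third straight walk joins the two summits.
-- A straight walk from the tangent lines of a parabola to their mirror image crosses every
-- hyperplane and so passes more than n - 2 vertices.

open import Defs
open import Data.Nat using (ℕ; zero; suc; _∸_)
open import Data.Fin using (Fin)
open import Data.Product using (_,_)

module FilterLength where

  open import Data.Empty using (⊥-elim)
  open import Data.Nat using (_≤_; _<_; z≤n; s≤s)
  open import Data.Nat.Properties using (m≤n⇒m≤1+n)
  open import Data.List using (List; []; _∷_; filter; length)
  open import Data.List.Relation.Unary.Any using (here; there)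
  open import Data.List.Membership.Propositional using (_∈_)
  open import Relation.Nullary using (¬_; yes; no)
  open import Relation.Unary using (Decidable)
  open import Relation.Binary.PropositionalEquality using (refl)

  module _ {A : Set} {P Q : A → Set} (P? : Decidable P) (Q? : Decidable Q) where

    filter-length-mono : ∀ xs → (∀ {x} → x ∈ xs → P x → Q x) → length (filter P? xs) ≤ length (filter Q? xs)
    filter-length-mono []       _   = z≤n
    filter-length-mono (x ∷ xs) P⇒Q with P? x | Q? x
    ... | yes _  | yes _  = s≤s (filter-length-mono xs (λ x∈ → P⇒Q (there x∈)))
    ... | yes px | no ¬qx = ⊥-elim (¬qx (P⇒Q (here refl) px))
    ... | no _   | yes _  = m≤n⇒m≤1+n (filter-length-mono xs (λ x∈ → P⇒Q (there x∈)))
    ... | no _   | no _   = filter-length-mono xs (λ x∈ → P⇒Q (there x∈))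

    filter-length-strict : ∀ xs → (∀ {x} → x ∈ xs → P x → Q x) → ∀ {y} → y ∈ xs → Q y → ¬ P y →
      length (filter P? xs) < length (filter Q? xs)
    filter-length-strict (x ∷ xs) P⇒Q (here refl) qy ¬py with P? x | Q? x
    ... | yes py | _      = ⊥-elim (¬py py)
    ... | no _   | no ¬qy = ⊥-elim (¬qy qy)
    ... | no _   | yes _  = s≤s (filter-length-mono xs (λ x∈ → P⇒Q (there x∈)))
    filter-length-strict (x ∷ xs) P⇒Q (there y∈) qy ¬py with P? x | Q? x
    ... | yes _  | yes _  = s≤s (filter-length-strict xs (λ x∈ → P⇒Q (there x∈)) y∈ qy ¬py)
    ... | yes px | no ¬qx = ⊥-elim (¬qx (P⇒Q (here refl) px))
    ... | no _   | yes _  = m≤n⇒m≤1+n (filter-length-strict xs (λ x∈ → P⇒Q (there x∈)) y∈ qy ¬py)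
    ... | no _   | no _   = filter-length-strict xs (λ x∈ → P⇒Q (there x∈)) y∈ qy ¬py

module FlipGraph (n : ℕ) where

  open import Data.Fin.Properties using (<-trans)
  open import Data.Product using (_,_)
  open import Relation.Binary.PropositionalEquality

  ≈-refl : ∀ {u : SignAssignment n} → u ≈ u
  ≈-refl _ _ _ _ _ = refl

  ≈-sym : ∀ {u v : SignAssignment n} → u ≈ v → v ≈ u
  ≈-sym u≈v i j k i<j j<k = sym (u≈v i j k i<j j<k)

  ≈-trans : ∀ {u v w : SignAssignment n} → u ≈ v → v ≈ w → u ≈ w
  ≈-trans u≈v v≈w i j k i<j j<k = trans (u≈v i j k i<j j<k) (v≈w i j k i<j j<k)

  signotope-resp-≈ : ∀ {u v : SignAssignment n} → u ≈ v → IsSignotope v → IsSignotope u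
  signotope-resp-≈ {u} {v} u≈v v-sig a b c d a<b b<c c<d
    rewrite u≈v a b c a<b b<c | u≈v a b d a<b (<-trans b<c c<d)
          | u≈v a c d (<-trans a<b b<c) c<d | u≈v b c d b<c c<d = v-sig a b c d a<b b<c c<d

  flip-respˡ-≈ : ∀ {u u' w : SignAssignment n} → u ≈ u' → Flip u' w → Flip u w
  flip-respˡ-≈ u≈u' (u'-sig , w-sig , i , j , k , i<j , j<k , differs , unique) =
    signotope-resp-≈ u≈u' u'-sig , w-sig , i , j , k , i<j , j<k ,
    (λ e → differs (trans (sym (u≈u' i j k i<j j<k)) e)) ,
    λ i' j' k' i'<j' j'<k' d' → unique i' j' k' i'<j' j'<k' (λ e → d' (trans (u≈u' i' j' k' i'<j' j'<k') e))

  flip-sym : ∀ {u w : SignAssignment n} → Flip u w → Flip w u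
  flip-sym (u-sig , w-sig , i , j , k , i<j , j<k , differs , unique) =
    w-sig , u-sig , i , j , k , i<j , j<k , (λ e → differs (sym e)) ,
    λ i' j' k' i'<j' j'<k' d' → unique i' j' k' i'<j' j'<k' (λ e → d' (sym e))

  module _ {P : SignAssignment n → Set} where

    Reach-respˡ-≈ : ∀ {u u' v} → u ≈ u' → Reach P u' v → Reach P u v
    Reach-respˡ-≈ u≈u' (here u'≈v)    = here (≈-trans u≈u' u'≈v)
    Reach-respˡ-≈ u≈u' (step fl pw r) = step (flip-respˡ-≈ u≈u' fl) pw r

    Reach-respʳ-≈ : ∀ {u v v'} → v ≈ v' → Reach P u v → Reach P u v'
    Reach-respʳ-≈ v≈v' (here u≈v)     = here (≈-trans u≈v v≈v')
    Reach-respʳ-≈ v≈v' (step fl pw r) = step fl pw (Reach-respʳ-≈ v≈v' r)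

    Reach-trans : ∀ {u v w} → Reach P u v → Reach P v w → Reach P u w
    Reach-trans (here u≈v)     r' = Reach-respˡ-≈ u≈v r'
    Reach-trans (step fl pw r) r' = step fl pw (Reach-trans r r')

    Reach-sym : ∀ {u v} → P u → Reach P u v → Reach P v u
    Reach-sym pu (here u≈v)     = here (≈-sym u≈v)
    Reach-sym pu (step fl pw r) = Reach-trans (Reach-sym pw r) (step (flip-sym fl) pu (here ≈-refl))

  Reach-map : ∀ {P Q : SignAssignment n → Set} → (∀ {w} → P w → Q w) → ∀ {u v} → Reach P u v → Reach Q u v
  Reach-map f (here u≈v)     = here u≈v
  Reach-map f (step fl pw r) = step fl (f pw) (Reach-map f r)

module RingSolver (R : RealNumbers) where

  open import Level using (0ℓ)
  open import Data.Maybe using (Maybe; just; nothing)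
  open import Data.Nat as ℕ using (ℕ; zero; suc)
  import Data.Nat.Properties as ℕ
  open import Data.Integer as ℤ using (ℤ; -[1+_]; _⊖_)
  import Data.Integer.Properties as ℤ
  open import Data.Sign as Sign using (Sign)
  open import Algebra.Bundles using (CommutativeRing; CommutativeMonoid)
  open import Algebra.Solver.Ring.AlmostCommutativeRing using (fromCommutativeRing; _-Raw-AlmostCommutative⟶_)
  open import Relation.Nullary using (yes; no)
  open import Relation.Binary.PropositionalEquality

  open RealNumbers R

  commutativeRing : CommutativeRing 0ℓ 0ℓ
  commutativeRing = record { isCommutativeRing = isCommutativeRing }

  open CommutativeRing commutativeRing
    using (+-comm; +-identityˡ; +-identityʳ; -‿inverseʳ; zeroˡ; zeroʳ; semiring; +-commutativeMonoid)
  open import Algebra.Properties.Ring (CommutativeRing.ring commutativeRing)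
    using (-‿distribˡ-*; -‿distribʳ-*; -‿involutive; -0#≈0#; -‿+-comm)
  open import Algebra.Properties.CommutativeSemigroup (CommutativeMonoid.commutativeSemigroup +-commutativeMonoid)
    using (interchange)
  open import Algebra.Properties.Semiring.Mult.TCOptimised semiring using (_×_; 1+×; ×-homo-+; ×1-homo-*)

  fromℤ : ℤ → ℝ
  fromℤ (ℤ.+ n)  = n × 1ℝ
  fromℤ -[1+ n ] = - (suc n × 1ℝ)

  private
    fromℤ-⊖ : ∀ m n → fromℤ (m ⊖ n) ≡ m × 1ℝ - n × 1ℝ
    fromℤ-⊖ m zero = begin
      fromℤ (m ⊖ 0)      ≡⟨ cong fromℤ (ℤ.⊖-≥ {m} ℕ.z≤n) ⟩
      m × 1ℝ             ≡⟨ +-identityʳ _ ⟨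
      m × 1ℝ + 0ℝ        ≡⟨ cong (m × 1ℝ +_) -0#≈0# ⟨
      m × 1ℝ - 0 × 1ℝ    ∎
      where open ≡-Reasoning
    fromℤ-⊖ zero (suc n) = trans (cong fromℤ (ℤ.⊖-< {0} {suc n} (ℕ.s≤s ℕ.z≤n))) (sym (+-identityˡ _))
    fromℤ-⊖ (suc m) (suc n) = begin
      fromℤ (suc m ⊖ suc n)                    ≡⟨ cong fromℤ (ℤ.[1+m]⊖[1+n]≡m⊖n m n) ⟩
      fromℤ (m ⊖ n)                            ≡⟨ fromℤ-⊖ m n ⟩
      x - y                                    ≡⟨ +-identityˡ _ ⟨
      0ℝ + (x - y)                             ≡⟨ cong (_+ (x - y)) (-‿inverseʳ 1ℝ) ⟨
      (1ℝ - 1ℝ) + (x - y)                      ≡⟨ interchange 1ℝ (- 1ℝ) x (- y) ⟩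
      (1ℝ + x) + (- 1ℝ + - y)                  ≡⟨ cong ((1ℝ + x) +_) (-‿+-comm 1ℝ y) ⟩
      (1ℝ + x) - (1ℝ + y)                      ≡⟨ cong₂ _-_ (1+× m 1ℝ) (1+× n 1ℝ) ⟨
      suc m × 1ℝ - suc n × 1ℝ                  ∎
      where
      open ≡-Reasoning
      x = m × 1ℝ
      y = n × 1ℝ

    fromℤ-+ : ∀ i j → fromℤ (i ℤ.+ j) ≡ fromℤ i + fromℤ j
    fromℤ-+ (ℤ.+ m)  (ℤ.+ n)  = ×-homo-+ 1ℝ m n
    fromℤ-+ (ℤ.+ m)  -[1+ n ] = fromℤ-⊖ m (suc n)
    fromℤ-+ -[1+ m ] (ℤ.+ n)  = trans (fromℤ-⊖ n (suc m)) (+-comm _ _)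
    fromℤ-+ -[1+ m ] -[1+ n ] = begin
      - (suc (suc (m ℕ.+ n)) × 1ℝ)         ≡⟨ cong (λ k → - (suc k × 1ℝ)) (ℕ.+-suc m n) ⟨
      - ((suc m ℕ.+ suc n) × 1ℝ)           ≡⟨ cong -_ (×-homo-+ 1ℝ (suc m) (suc n)) ⟩
      - (suc m × 1ℝ + suc n × 1ℝ)          ≡⟨ -‿+-comm _ _ ⟨
      - (suc m × 1ℝ) + - (suc n × 1ℝ)      ∎
      where open ≡-Reasoning

    signed : Sign → ℝ → ℝ
    signed Sign.+ x = x
    signed Sign.- x = - x

    fromℤ-◃ : ∀ s k → fromℤ (s ℤ.◃ k) ≡ signed s (k × 1ℝ)
    fromℤ-◃ Sign.+ zero    = refl
    fromℤ-◃ Sign.- zero    = sym -0#≈0#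
    fromℤ-◃ Sign.+ (suc k) = refl
    fromℤ-◃ Sign.- (suc k) = refl

    fromℤ-* : ∀ i j → fromℤ (i ℤ.* j) ≡ fromℤ i * fromℤ j
    fromℤ-* (ℤ.+ m)       (ℤ.+ n)       = trans (fromℤ-◃ Sign.+ (m ℕ.* n)) (×1-homo-* m n)
    fromℤ-* (ℤ.+ zero)    -[1+ n ]      = sym (zeroˡ _)
    fromℤ-* (ℤ.+ (suc m)) -[1+ n ]      =
      trans (fromℤ-◃ Sign.- (suc m ℕ.* suc n)) (trans (cong -_ (×1-homo-* (suc m) (suc n))) (-‿distribʳ-* _ _))
    fromℤ-* -[1+ m ]      (ℤ.+ zero)    = trans (cong fromℤ (ℤ.*-zeroʳ -[1+ m ])) (sym (zeroʳ _))
    fromℤ-* -[1+ m ]      (ℤ.+ (suc n)) =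
      trans (fromℤ-◃ Sign.- (suc m ℕ.* suc n)) (trans (cong -_ (×1-homo-* (suc m) (suc n))) (-‿distribˡ-* _ _))
    fromℤ-* -[1+ m ]      -[1+ n ]      = begin
      fromℤ (Sign.+ ℤ.◃ (suc m ℕ.* suc n))  ≡⟨ fromℤ-◃ Sign.+ (suc m ℕ.* suc n) ⟩
      (suc m ℕ.* suc n) × 1ℝ               ≡⟨ ×1-homo-* (suc m) (suc n) ⟩
      x * y                                ≡⟨ -‿involutive _ ⟨
      - - (x * y)                          ≡⟨ cong -_ (-‿distribˡ-* x y) ⟩
      - (- x * y)                          ≡⟨ -‿distribʳ-* (- x) y ⟩
      - x * - y                            ∎
      where
      open ≡-Reasoning
      x = suc m × 1ℝ
      y = suc n × 1ℝ

    fromℤ-neg : ∀ i → fromℤ (ℤ.- i) ≡ - fromℤ i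
    fromℤ-neg -[1+ n ]      = sym (-‿involutive _)
    fromℤ-neg (ℤ.+ zero)    = sym -0#≈0#
    fromℤ-neg (ℤ.+ (suc n)) = refl

  fromℤ-homomorphism : ℤ.+-*-rawRing -Raw-AlmostCommutative⟶ fromCommutativeRing commutativeRing
  fromℤ-homomorphism = record
    { ⟦_⟧ = fromℤ ; +-homo = fromℤ-+ ; *-homo = fromℤ-* ; -‿homo = fromℤ-neg ; 0-homo = refl ; 1-homo = refl }

  private
    fromℤ-≟ : ∀ i j → Maybe (fromℤ i ≡ fromℤ j)
    fromℤ-≟ i j with i ℤ.≟ j
    ... | yes i≡j = just (cong fromℤ i≡j)
    ... | no _    = nothing

  open import Algebra.Solver.Ring ℤ.+-*-rawRing (fromCommutativeRing commutativeRing) fromℤ-homomorphism fromℤ-≟ public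

module OrderedField (R : RealNumbers) where

  open import Data.Empty using (⊥-elim)
  open import Data.Integer using (1ℤ)
  open import Data.Product using (Σ; _×_; _,_; proj₁; proj₂)
  open import Data.Sum using (_⊎_; inj₁; inj₂)
  open import Data.List using (List; []; _∷_)
  open import Data.List.Relation.Unary.Any using (here; there)
  open import Data.List.Membership.Propositional using (_∈_)
  open import Relation.Nullary using (¬_; yes; no)
  open import Relation.Binary.Definitions using (tri<; tri≈; tri>)
  open import Relation.Binary.Structures using (IsStrictTotalOrder; IsStrictPartialOrder)
  open import Relation.Binary.PropositionalEquality
  open import Algebra.Bundles using (CommutativeRing)

  open RealNumbers R public renaming (+-mono-< to +-monoˡ-<)
  open RingSolver R public using (solve; _:=_; con; _:+_; _:*_; _:-_; :-_)
  open CommutativeRing (RingSolver.commutativeRing R) public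
    using (+-comm; *-comm; +-identityˡ; +-identityʳ; *-identityʳ; -‿inverseʳ; zeroˡ; zeroʳ)
  open import Algebra.Properties.Ring (CommutativeRing.ring (RingSolver.commutativeRing R)) public
    using (-‿involutive; -0#≈0#; -‿distribʳ-*)

  open IsStrictTotalOrder isStrictTotalOrder public using (compare) renaming (_≟_ to _≟ℝ_; _<?_ to _<?ℝ_)
  private module SPO = IsStrictPartialOrder (IsStrictTotalOrder.isStrictPartialOrder isStrictTotalOrder)

  <-trans : ∀ {x y z} → x <ℝ y → y <ℝ z → x <ℝ z
  <-trans = SPO.trans

  <-irrefl : ∀ {x} → ¬ (x <ℝ x)
  <-irrefl = SPO.irrefl refl

  <-asym : ∀ {x y} → x <ℝ y → ¬ (y <ℝ x)
  <-asym p q = <-irrefl (<-trans p q)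

  <⇒≢ : ∀ {x y} → x <ℝ y → x ≢ y
  <⇒≢ p refl = <-irrefl p

  <⇒≢0 : ∀ {x} → x <ℝ 0ℝ → x ≢ 0ℝ
  <⇒≢0 = <⇒≢

  >⇒≢ : ∀ {x y} → x <ℝ y → y ≢ x
  >⇒≢ p refl = <-irrefl p

  >⇒≢0 : ∀ {x} → 0ℝ <ℝ x → x ≢ 0ℝ
  >⇒≢0 = >⇒≢

  <-resp-≡ : ∀ {x y x' y'} → x ≡ x' → y ≡ y' → x <ℝ y → x' <ℝ y'
  <-resp-≡ refl refl p = p

  infix 4 _≤ℝ_

  _≤ℝ_ : ℝ → ℝ → Set
  x ≤ℝ y = x <ℝ y ⊎ x ≡ y

  ≤-refl : ∀ {x} → x ≤ℝ x
  ≤-refl = inj₂ refl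

  ≤-trans : ∀ {x y z} → x ≤ℝ y → y ≤ℝ z → x ≤ℝ z
  ≤-trans (inj₁ x<y) (inj₁ y<z) = inj₁ (<-trans x<y y<z)
  ≤-trans (inj₁ x<y) (inj₂ refl) = inj₁ x<y
  ≤-trans (inj₂ refl) y≤z        = y≤z

  ≤-<-trans : ∀ {x y z} → x ≤ℝ y → y <ℝ z → x <ℝ z
  ≤-<-trans (inj₁ x<y) y<z = <-trans x<y y<z
  ≤-<-trans (inj₂ refl) y<z = y<z

  <-≤-trans : ∀ {x y z} → x <ℝ y → y ≤ℝ z → x <ℝ z
  <-≤-trans x<y (inj₁ y<z) = <-trans x<y y<z
  <-≤-trans x<y (inj₂ refl) = x<y

  ≤⇒≯ : ∀ {x y} → x ≤ℝ y → ¬ (y <ℝ x)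
  ≤⇒≯ (inj₁ x<y) y<x = <-asym x<y y<x
  ≤⇒≯ (inj₂ refl) x<x = <-irrefl x<x

  ≢0⇒<0⊎>0 : ∀ {x} → x ≢ 0ℝ → (x <ℝ 0ℝ) ⊎ (0ℝ <ℝ x)
  ≢0⇒<0⊎>0 {x} x≢0 with compare x 0ℝ
  ... | tri< x<0 _ _ = inj₁ x<0
  ... | tri≈ _ x≡0 _ = ⊥-elim (x≢0 x≡0)
  ... | tri> _ _ x>0 = inj₂ x>0

  ≮0⇒≢0⇒>0 : ∀ {x} → ¬ (x <ℝ 0ℝ) → x ≢ 0ℝ → 0ℝ <ℝ x
  ≮0⇒≢0⇒>0 x≮0 x≢0 with ≢0⇒<0⊎>0 x≢0
  ... | inj₁ x<0 = ⊥-elim (x≮0 x<0)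
  ... | inj₂ x>0 = x>0

  +-monoʳ-< : ∀ {x y} z → x <ℝ y → z + x <ℝ z + y
  +-monoʳ-< {x} {y} z p = <-resp-≡ (+-comm x z) (+-comm y z) (+-monoˡ-< z p)

  +-mono-< : ∀ {a b c d} → a <ℝ b → c <ℝ d → a + c <ℝ b + d
  +-mono-< {b = b} {c = c} p q = <-trans (+-monoˡ-< c p) (+-monoʳ-< b q)

  +-mono-<-≤ : ∀ {a b c d} → a <ℝ b → c ≤ℝ d → a + c <ℝ b + d
  +-mono-<-≤ p (inj₁ q)    = +-mono-< p q
  +-mono-<-≤ p (inj₂ refl) = +-monoˡ-< _ p

  +-mono-≤-< : ∀ {a b c d} → a ≤ℝ b → c <ℝ d → a + c <ℝ b + d
  +-mono-≤-< (inj₁ p)    q = +-mono-< p q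
  +-mono-≤-< (inj₂ refl) q = +-monoʳ-< _ q

  +-mono-≤ : ∀ {a b c d} → a ≤ℝ b → c ≤ℝ d → a + c ≤ℝ b + d
  +-mono-≤ p (inj₁ q)    = inj₁ (+-mono-≤-< p q)
  +-mono-≤ (inj₁ p) (inj₂ refl) = inj₁ (+-monoˡ-< _ p)
  +-mono-≤ (inj₂ refl) (inj₂ refl) = ≤-refl

  x<y⇒0<y-x : ∀ {x y} → x <ℝ y → 0ℝ <ℝ y - x
  x<y⇒0<y-x {x} p = <-resp-≡ (-‿inverseʳ x) refl (+-monoˡ-< (- x) p)

  0<y-x⇒x<y : ∀ {x y} → 0ℝ <ℝ y - x → x <ℝ y
  0<y-x⇒x<y {x} {y} p =
    <-resp-≡ (+-identityˡ x) (solve 2 (λ x y → y :- x :+ x := y) refl x y) (+-monoˡ-< x p)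

  x-y≡0⇒x≡y : ∀ {x y} → x - y ≡ 0ℝ → x ≡ y
  x-y≡0⇒x≡y {x} {y} e =
    trans (solve 2 (λ x y → x := (x :- y) :+ y) refl x y) (trans (cong (_+ y) e) (+-identityˡ y))

  neg-antimono-< : ∀ {x y} → x <ℝ y → - y <ℝ - x
  neg-antimono-< {x} {y} p =
    0<y-x⇒x<y (<-resp-≡ refl (solve 2 (λ x y → y :- x := (:- x) :- (:- y)) refl x y) (x<y⇒0<y-x p))

  >0⇒-<0 : ∀ {x} → 0ℝ <ℝ x → - x <ℝ 0ℝ
  >0⇒-<0 p = <-resp-≡ refl -0#≈0# (neg-antimono-< p)

  x<y⇒x-y<0 : ∀ {x y} → x <ℝ y → x - y <ℝ 0ℝ
  x<y⇒x-y<0 {x} {y} p = <-resp-≡ (solve 2 (λ x y → :- (y :- x) := x :- y) refl x y) refl (>0⇒-<0 (x<y⇒0<y-x p))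

  <0⇒->0 : ∀ {x} → x <ℝ 0ℝ → 0ℝ <ℝ - x
  <0⇒->0 p = <-resp-≡ -0#≈0# refl (neg-antimono-< p)

  +-pos : ∀ {x y} → 0ℝ <ℝ x → 0ℝ <ℝ y → 0ℝ <ℝ x + y
  +-pos p q = <-resp-≡ (+-identityˡ 0ℝ) refl (+-mono-< p q)

  +-neg : ∀ {x y} → x <ℝ 0ℝ → y <ℝ 0ℝ → x + y <ℝ 0ℝ
  +-neg p q = <-resp-≡ refl (+-identityˡ 0ℝ) (+-mono-< p q)

  *-pos-neg : ∀ {x y} → 0ℝ <ℝ x → y <ℝ 0ℝ → x * y <ℝ 0ℝ
  *-pos-neg {x} {y} p q =
    <-resp-≡ (-‿involutive _) -0#≈0# (neg-antimono-< (<-resp-≡ refl (sym (-‿distribʳ-* x y)) (*-pos p (<0⇒->0 q))))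

  *-neg-pos : ∀ {x y} → x <ℝ 0ℝ → 0ℝ <ℝ y → x * y <ℝ 0ℝ
  *-neg-pos {x} {y} p q = <-resp-≡ (*-comm y x) refl (*-pos-neg q p)

  *-neg-neg : ∀ {x y} → x <ℝ 0ℝ → y <ℝ 0ℝ → 0ℝ <ℝ x * y
  *-neg-neg {x} {y} p q =
    <-resp-≡ refl (solve 2 (λ x y → :- x :* :- y := x :* y) refl x y) (*-pos (<0⇒->0 p) (<0⇒->0 q))

  *-≢0 : ∀ {x y} → x ≢ 0ℝ → y ≢ 0ℝ → x * y ≢ 0ℝ
  *-≢0 p q with ≢0⇒<0⊎>0 p | ≢0⇒<0⊎>0 q
  ... | inj₁ x<0 | inj₁ y<0 = >⇒≢0 (*-neg-neg x<0 y<0)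
  ... | inj₁ x<0 | inj₂ y>0 = <⇒≢0 (*-neg-pos x<0 y>0)
  ... | inj₂ x>0 | inj₁ y<0 = <⇒≢0 (*-pos-neg x>0 y<0)
  ... | inj₂ x>0 | inj₂ y>0 = >⇒≢0 (*-pos x>0 y>0)

  *-monoˡ-< : ∀ {c x y} → 0ℝ <ℝ c → x <ℝ y → c * x <ℝ c * y
  *-monoˡ-< {c} {x} {y} p q = 0<y-x⇒x<y
    (<-resp-≡ refl (solve 3 (λ c x y → c :* (y :- x) := c :* y :- c :* x) refl c x y) (*-pos p (x<y⇒0<y-x q)))

  *-cancelˡ-pos : ∀ {c x} → 0ℝ <ℝ c → 0ℝ <ℝ c * x → 0ℝ <ℝ x
  *-cancelˡ-pos {c} {x} p q with compare x 0ℝ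
  ... | tri< x<0 _ _ = ⊥-elim (<-asym q (*-pos-neg p x<0))
  ... | tri≈ _ refl _ = ⊥-elim (<-irrefl (<-resp-≡ refl (zeroʳ c) q))
  ... | tri> _ _ x>0 = x>0

  *-cancelˡ-neg : ∀ {c x} → 0ℝ <ℝ c → c * x <ℝ 0ℝ → x <ℝ 0ℝ
  *-cancelˡ-neg {c} {x} p q with compare x 0ℝ
  ... | tri< x<0 _ _ = x<0
  ... | tri≈ _ refl _ = ⊥-elim (<-irrefl (<-resp-≡ (zeroʳ c) refl q))
  ... | tri> _ _ x>0 = ⊥-elim (<-asym q (*-pos p x>0))

  0<1 : 0ℝ <ℝ 1ℝ
  0<1 with compare 0ℝ 1ℝ
  ... | tri< 0<1 _ _ = 0<1
  ... | tri≈ _ 0≡1 _ = ⊥-elim (0≢1 0≡1)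
  ... | tri> _ _ 1<0 = ⊥-elim (<-asym 1<0
    (<-resp-≡ refl (*-identityʳ 1ℝ) (*-neg-neg 1<0 1<0)))

  -- The junk value 0ℝ ⁻¹ = 0ℝ is never used: every lemma assumes x ≢ 0ℝ.
  _⁻¹ : ℝ → ℝ
  x ⁻¹ with x ≟ℝ 0ℝ
  ... | yes _   = 0ℝ
  ... | no x≢0 = proj₁ (inverse x x≢0)

  *-inverseʳ : ∀ {x} → x ≢ 0ℝ → x * x ⁻¹ ≡ 1ℝ
  *-inverseʳ {x} x≢0 with x ≟ℝ 0ℝ
  ... | yes x≡0 = ⊥-elim (x≢0 x≡0)
  ... | no x≢0' = proj₂ (inverse x x≢0')

  ⁻¹-pos : ∀ {x} → 0ℝ <ℝ x → 0ℝ <ℝ x ⁻¹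
  ⁻¹-pos x>0 = *-cancelˡ-pos x>0 (<-resp-≡ refl (sym (*-inverseʳ (>⇒≢0 x>0))) 0<1)

  ⁻¹-neg : ∀ {x} → x <ℝ 0ℝ → x ⁻¹ <ℝ 0ℝ
  ⁻¹-neg {x} x<0 = <-resp-≡ (-‿involutive _) -0#≈0# (neg-antimono-< (*-cancelˡ-pos (<0⇒->0 x<0) 0<-x*x⁻¹))
    where
    0<-x*x⁻¹ : 0ℝ <ℝ - x * - (x ⁻¹)
    0<-x*x⁻¹ = <-resp-≡ refl
      (trans (sym (*-inverseʳ (<⇒≢0 x<0))) (solve 2 (λ x y → x :* y := :- x :* :- y) refl x (x ⁻¹))) 0<1

  ½ : ℝ
  ½ = (1ℝ + 1ℝ) ⁻¹

  0<½ : 0ℝ <ℝ ½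
  0<½ = ⁻¹-pos (+-pos 0<1 0<1)

  halves : ∀ x → x * ½ + x * ½ ≡ x
  halves x = begin
    x * ½ + x * ½      ≡⟨ solve 2 (λ x h → x :* h :+ x :* h := x :* ((con 1ℤ :+ con 1ℤ) :* h)) refl x ½ ⟩
    x * ((1ℝ + 1ℝ) * ½) ≡⟨ cong (x *_) (*-inverseʳ (>⇒≢0 (+-pos 0<1 0<1))) ⟩
    x * 1ℝ             ≡⟨ *-identityʳ x ⟩
    x                  ∎
    where open ≡-Reasoning

  *½-< : ∀ {x} → 0ℝ <ℝ x → x * ½ <ℝ x
  *½-< {x} x>0 = <-resp-≡ (+-identityˡ _) (halves x) (+-monoˡ-< (x * ½) (*-pos x>0 0<½))

  mid : ℝ → ℝ → ℝ
  mid a b = (a + b) * ½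

  mid-gap : ∀ a b → (b - a) * ½ ≡ mid a b - a × (b - a) * ½ ≡ b - mid a b
  mid-gap a b =
    trans (solve 3 (λ a b h → (b :- a) :* h := (a :+ b) :* h :- (a :* h :+ a :* h)) refl a b ½) (cong (λ z → mid a b - z) (halves a)) ,
    trans (solve 3 (λ a b h → (b :- a) :* h := (b :* h :+ b :* h) :- (a :+ b) :* h) refl a b ½) (cong (λ z → z - mid a b) (halves b))

  mid-l : ∀ {a b} → a <ℝ b → a <ℝ mid a b
  mid-l {a} {b} a<b = 0<y-x⇒x<y (<-resp-≡ refl (proj₁ (mid-gap a b)) (*-pos (x<y⇒0<y-x a<b) 0<½))

  mid-r : ∀ {a b} → a <ℝ b → mid a b <ℝ b
  mid-r {a} {b} a<b = 0<y-x⇒x<y (<-resp-≡ refl (proj₂ (mid-gap a b)) (*-pos (x<y⇒0<y-x a<b) 0<½))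

  *-monoʳ-≤ : ∀ {c x y} → 0ℝ <ℝ c → x ≤ℝ y → x * c ≤ℝ y * c
  *-monoʳ-≤ {c} {x} {y} c>0 (inj₁ x<y) = inj₁ (<-resp-≡ (*-comm c x) (*-comm c y) (*-monoˡ-< c>0 x<y))
  *-monoʳ-≤ c>0 (inj₂ refl) = ≤-refl

  lower-bound : ∀ {a b} → 0ℝ <ℝ a → 0ℝ <ℝ b → Σ ℝ λ ε → 0ℝ <ℝ ε × ε ≤ℝ a × ε ≤ℝ b
  lower-bound {a} {b} a>0 b>0 with compare a b
  ... | tri< a<b _ _ = a , a>0 , ≤-refl , inj₁ a<b
  ... | tri≈ _ refl _ = a , a>0 , ≤-refl , ≤-refl
  ... | tri> _ _ b<a = b , b>0 , inj₁ b<a , ≤-refl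

  open import Data.List using (List; []; _∷_)
  open import Data.List.Relation.Unary.Any using (here; there)
  open import Data.List.Membership.Propositional using (_∈_)

  private
    below : ∀ {A : Set} {xs : List A} {f : A → ℝ} {a b s y} → a <ℝ f y → f y ≤ℝ s → s <ℝ b →
      (∀ {x} → x ∈ xs → s <ℝ f x) → Σ ℝ λ s' → a <ℝ s' × s' <ℝ b × (∀ {x} → x ∈ y ∷ xs → s' <ℝ f x)
    below a<fy fy≤s s<b s<f = mid _ _ , mid-l a<fy , <-trans (<-≤-trans (mid-r a<fy) fy≤s) s<b ,
      λ { (here refl) → mid-r a<fy ; (there x∈) → <-trans (<-≤-trans (mid-r a<fy) fy≤s) (s<f x∈) }

  exists-between : ∀ {A : Set} (xs : List A) (f : A → ℝ) {a b} → a <ℝ b → (∀ {x} → x ∈ xs → a <ℝ f x) →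
    Σ ℝ λ s → a <ℝ s × s <ℝ b × (∀ {x} → x ∈ xs → s <ℝ f x)
  exists-between []       f a<b _   = mid _ _ , mid-l a<b , mid-r a<b , λ ()
  exists-between (y ∷ xs) f a<b a<f with exists-between xs f a<b (λ x∈ → a<f (there x∈))
  ... | s , a<s , s<b , s<f with compare s (f y)
  ...   | tri< s<fy _ _ = s , a<s , s<b , λ { (here refl) → s<fy ; (there x∈) → s<f x∈ }
  ...   | tri≈ _ s≡fy _ = below (a<f (here refl)) (inj₂ (sym s≡fy)) s<b s<f
  ...   | tri> _ _ fy<s = below (a<f (here refl)) (inj₁ fy<s) s<b s<f

  argmin : ∀ {A : Set} (f : A → ℝ) {x} (xs : List A) → x ∈ xs →
    Σ A λ m → m ∈ xs × (∀ {y} → y ∈ xs → f m ≤ℝ f y)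
  argmin f (x ∷ [])     _ = x , here refl , λ { (here refl) → ≤-refl }
  argmin f (x ∷ z ∷ xs) _ with argmin f (z ∷ xs) (here refl)
  ... | m , m∈ , m-min with compare (f x) (f m)
  ...   | tri< fx<fm _ _ = x , here refl , λ
          { (here refl) → ≤-refl ; (there y∈) → ≤-trans (inj₁ fx<fm) (m-min y∈) }
  ...   | tri≈ _ fx≡fm _ = m , there m∈ , λ
          { (here refl) → inj₂ (sym fx≡fm) ; (there y∈) → m-min y∈ }
  ...   | tri> _ _ fm<fx = m , there m∈ , λ
          { (here refl) → inj₁ fm<fx ; (there y∈) → m-min y∈ }

  sumOver : ∀ {A : Set} → List A → (A → ℝ) → ℝ
  sumOver []       f = 0ℝ
  sumOver (t ∷ ts) f = f t + sumOver ts f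

  module _ {A : Set} where

    sumOver-cong : ∀ (ts : List A) {f g} → (∀ {t} → t ∈ ts → f t ≡ g t) → sumOver ts f ≡ sumOver ts g
    sumOver-cong []       _   = refl
    sumOver-cong (t ∷ ts) f≗g = cong₂ _+_ (f≗g (here refl)) (sumOver-cong ts (λ t∈ → f≗g (there t∈)))

    sumOver-mono-≤ : ∀ (ts : List A) {f g} → (∀ {t} → t ∈ ts → f t ≤ℝ g t) → sumOver ts f ≤ℝ sumOver ts g
    sumOver-mono-≤ []       _   = ≤-refl
    sumOver-mono-≤ (t ∷ ts) f≤g = +-mono-≤ (f≤g (here refl)) (sumOver-mono-≤ ts (λ t∈ → f≤g (there t∈)))

    sumOver-mono-< : ∀ (ts : List A) {f g} → (∀ {t} → t ∈ ts → f t ≤ℝ g t) → ∀ {t} → t ∈ ts → f t <ℝ g t →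
      sumOver ts f <ℝ sumOver ts g
    sumOver-mono-< (t ∷ ts) f≤g (here refl) ft<gt =
      +-mono-<-≤ ft<gt (sumOver-mono-≤ ts (λ t∈ → f≤g (there t∈)))
    sumOver-mono-< (t ∷ ts) f≤g (there t∈) ft<gt =
      +-mono-≤-< (f≤g (here refl)) (sumOver-mono-< ts (λ t∈ → f≤g (there t∈)) t∈ ft<gt)

module Signs (R : RealNumbers) where

  open import Data.Bool using (Bool; true; false)
  open import Data.Empty using (⊥-elim)
  open import Data.Integer using (0ℤ; 1ℤ)
  open import Data.Product using (Σ; _×_; _,_)
  open import Data.Sum using (_⊎_; inj₁; inj₂)
  open import Data.List using (List; []; _∷_)
  open import Data.List.Relation.Unary.Any using (here; there)
  open import Data.List.Membership.Propositional using (_∈_)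
  open import Relation.Nullary using (¬_; Dec; yes; no)
  open import Relation.Binary.Definitions using (tri<; tri≈; tri>)
  open import Relation.Binary.PropositionalEquality

  open OrderedField R

  SameSign : ℝ → ℝ → Set
  SameSign a b = ((0ℝ <ℝ a) × (0ℝ <ℝ b)) ⊎ ((a <ℝ 0ℝ) × (b <ℝ 0ℝ))

  Opposite : ℝ → ℝ → Set
  Opposite a b = ((0ℝ <ℝ a) × (b <ℝ 0ℝ)) ⊎ ((a <ℝ 0ℝ) × (0ℝ <ℝ b))

  same⇒≢0 : ∀ {a b} → SameSign a b → a ≢ 0ℝ
  same⇒≢0 (inj₁ (a>0 , _)) = >⇒≢0 a>0
  same⇒≢0 (inj₂ (a<0 , _)) = <⇒≢0 a<0

  opposite⇒≢0 : ∀ {a b} → Opposite a b → b ≢ 0ℝ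
  opposite⇒≢0 (inj₁ (_ , b<0)) = <⇒≢0 b<0
  opposite⇒≢0 (inj₂ (_ , b>0)) = >⇒≢0 b>0

  same-refl : ∀ {a} → a ≢ 0ℝ → SameSign a a
  same-refl a≢0 with ≢0⇒<0⊎>0 a≢0
  ... | inj₁ a<0 = inj₂ (a<0 , a<0)
  ... | inj₂ a>0 = inj₁ (a>0 , a>0)

  same-sym : ∀ {a b} → SameSign a b → SameSign b a
  same-sym (inj₁ (p , q)) = inj₁ (q , p)
  same-sym (inj₂ (p , q)) = inj₂ (q , p)

  same-trans : ∀ {a b c} → SameSign a b → SameSign b c → SameSign a c
  same-trans (inj₁ (p , _)) (inj₁ (_ , s)) = inj₁ (p , s)
  same-trans (inj₁ (_ , q)) (inj₂ (r , _)) = ⊥-elim (<-asym q r)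
  same-trans (inj₂ (_ , q)) (inj₁ (r , _)) = ⊥-elim (<-asym q r)
  same-trans (inj₂ (p , _)) (inj₂ (_ , s)) = inj₂ (p , s)

  opposite-sym : ∀ {a b} → Opposite a b → Opposite b a
  opposite-sym (inj₁ (p , q)) = inj₂ (q , p)
  opposite-sym (inj₂ (p , q)) = inj₁ (q , p)

  same-opposite-trans : ∀ {a b c} → SameSign a b → Opposite b c → Opposite a c
  same-opposite-trans (inj₁ (p , _)) (inj₁ (_ , s)) = inj₁ (p , s)
  same-opposite-trans (inj₁ (_ , q)) (inj₂ (r , _)) = ⊥-elim (<-asym q r)
  same-opposite-trans (inj₂ (_ , q)) (inj₁ (r , _)) = ⊥-elim (<-asym q r)
  same-opposite-trans (inj₂ (p , _)) (inj₂ (_ , s)) = inj₂ (p , s)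

  opposite-trans : ∀ {a b c} → Opposite a b → Opposite b c → SameSign a c
  opposite-trans (inj₁ (_ , q)) (inj₁ (r , _)) = ⊥-elim (<-asym q r)
  opposite-trans (inj₁ (p , _)) (inj₂ (_ , s)) = inj₁ (p , s)
  opposite-trans (inj₂ (p , _)) (inj₁ (_ , s)) = inj₂ (p , s)
  opposite-trans (inj₂ (_ , q)) (inj₂ (r , _)) = ⊥-elim (<-asym q r)

  same⇒¬opposite : ∀ {a b} → SameSign a b → ¬ Opposite a b
  same⇒¬opposite (inj₁ (_ , q)) (inj₁ (_ , s)) = <-asym q s
  same⇒¬opposite (inj₁ (p , _)) (inj₂ (r , _)) = <-asym p r
  same⇒¬opposite (inj₂ (p , _)) (inj₁ (r , _)) = <-asym p r
  same⇒¬opposite (inj₂ (_ , q)) (inj₂ (_ , s)) = <-asym q s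

  same⊎opposite : ∀ {a b} → a ≢ 0ℝ → b ≢ 0ℝ → SameSign a b ⊎ Opposite a b
  same⊎opposite a≢0 b≢0 with ≢0⇒<0⊎>0 a≢0 | ≢0⇒<0⊎>0 b≢0
  ... | inj₁ p | inj₁ q = inj₁ (inj₂ (p , q))
  ... | inj₁ p | inj₂ q = inj₂ (inj₂ (p , q))
  ... | inj₂ p | inj₁ q = inj₂ (inj₁ (p , q))
  ... | inj₂ p | inj₂ q = inj₁ (inj₁ (p , q))

  same-neg-opposite : ∀ {a b} → SameSign a b → Opposite a (- b)
  same-neg-opposite (inj₁ (p , q)) = inj₁ (p , >0⇒-<0 q)
  same-neg-opposite (inj₂ (p , q)) = inj₂ (p , <0⇒->0 q)

  same-+ : ∀ {x y a} → SameSign x a → SameSign y a → SameSign (x + y) a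
  same-+ (inj₁ (p , q)) (inj₁ (r , _)) = inj₁ (+-pos p r , q)
  same-+ (inj₁ (_ , q)) (inj₂ (_ , s)) = ⊥-elim (<-asym q s)
  same-+ (inj₂ (_ , q)) (inj₁ (_ , s)) = ⊥-elim (<-asym q s)
  same-+ (inj₂ (p , q)) (inj₂ (r , _)) = inj₂ (+-neg p r , q)

  same⇒0<* : ∀ {a b} → SameSign a b → 0ℝ <ℝ a * b
  same⇒0<* (inj₁ (p , q)) = *-pos p q
  same⇒0<* (inj₂ (p , q)) = *-neg-neg p q

  same-*ʳ-pos : ∀ {a b c} → SameSign a b → 0ℝ <ℝ c → SameSign (a * c) b
  same-*ʳ-pos (inj₁ (p , q)) c>0 = inj₁ (*-pos p c>0 , q)
  same-*ʳ-pos (inj₂ (p , q)) c>0 = inj₂ (*-neg-pos p c>0 , q)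

  same-*ˡ-pos : ∀ {a b c} → SameSign a b → 0ℝ <ℝ c → SameSign (c * a) b
  same-*ˡ-pos {a} {b} {c} a∼b c>0 = subst (λ w → SameSign w b) (*-comm a c) (same-*ʳ-pos a∼b c>0)

  same-*ʳ-neg : ∀ {a b c} → SameSign a b → c <ℝ 0ℝ → Opposite (a * c) b
  same-*ʳ-neg (inj₁ (p , q)) c<0 = inj₂ (*-pos-neg p c<0 , q)
  same-*ʳ-neg (inj₂ (p , q)) c<0 = inj₁ (*-neg-neg p c<0 , q)

  same-*ˡ-cancel : ∀ {α y x} → 0ℝ <ℝ α → SameSign (α * y) x → SameSign y x
  same-*ˡ-cancel α>0 (inj₁ (p , q)) = inj₁ (*-cancelˡ-pos α>0 p , q)
  same-*ˡ-cancel α>0 (inj₂ (p , q)) = inj₂ (*-cancelˡ-neg α>0 p , q)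

  same-⁻¹ : ∀ {a b} → SameSign a b → SameSign (a ⁻¹) b
  same-⁻¹ (inj₁ (p , q)) = inj₁ (⁻¹-pos p , q)
  same-⁻¹ (inj₂ (p , q)) = inj₂ (⁻¹-neg p , q)

  positive-combination : ∀ {α β γ x y z} → 0ℝ <ℝ α → 0ℝ <ℝ β → 0ℝ <ℝ γ →
    α * y ≡ β * x + γ * z → SameSign x z → SameSign y x
  positive-combination {x = x} α>0 β>0 γ>0 eq x∼z = same-*ˡ-cancel α>0 (subst (λ w → SameSign w x) (sym eq)
    (same-+ (same-*ˡ-pos (same-refl (same⇒≢0 x∼z)) β>0) (same-*ˡ-pos (same-sym x∼z) γ>0)))

  isNegative : ℝ → Bool
  isNegative x with compare x 0ℝ
  ... | tri< _ _ _ = true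
  ... | tri≈ _ _ _ = false
  ... | tri> _ _ _ = false

  isNegative≡true⇒<0 : ∀ {x} → isNegative x ≡ true → x <ℝ 0ℝ
  isNegative≡true⇒<0 {x} e with compare x 0ℝ
  isNegative≡true⇒<0 e  | tri< x<0 _ _ = x<0
  isNegative≡true⇒<0 () | tri≈ _ _ _
  isNegative≡true⇒<0 () | tri> _ _ _

  isNegative≡false⇒≮0 : ∀ {x} → isNegative x ≡ false → ¬ (x <ℝ 0ℝ)
  isNegative≡false⇒≮0 {x} e with compare x 0ℝ
  isNegative≡false⇒≮0 () | tri< _ _ _
  isNegative≡false⇒≮0 e  | tri≈ x≮0 _ _ = x≮0
  isNegative≡false⇒≮0 e  | tri> x≮0 _ _ = x≮0

  <0⇒isNegative : ∀ {x} → x <ℝ 0ℝ → isNegative x ≡ true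
  <0⇒isNegative {x} x<0 with compare x 0ℝ
  ... | tri< _ _ _ = refl
  ... | tri≈ x≮0 _ _ = ⊥-elim (x≮0 x<0)
  ... | tri> x≮0 _ _ = ⊥-elim (x≮0 x<0)

  >0⇒¬isNegative : ∀ {x} → 0ℝ <ℝ x → isNegative x ≡ false
  >0⇒¬isNegative {x} x>0 with compare x 0ℝ
  ... | tri< x<0 _ _ = ⊥-elim (<-asym x<0 x>0)
  ... | tri≈ _ _ _ = refl
  ... | tri> _ _ _ = refl

  isNegative-same : ∀ {x y} → SameSign x y → isNegative x ≡ isNegative y
  isNegative-same (inj₁ (p , q)) = trans (>0⇒¬isNegative p) (sym (>0⇒¬isNegative q))
  isNegative-same (inj₂ (p , q)) = trans (<0⇒isNegative p) (sym (<0⇒isNegative q))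

  isNegative-opposite : ∀ {x y} → Opposite x y → isNegative x ≢ isNegative y
  isNegative-opposite (inj₁ (p , q)) e with trans (sym (>0⇒¬isNegative p)) (trans e (<0⇒isNegative q))
  ... | ()
  isNegative-opposite (inj₂ (p , q)) e with trans (sym (<0⇒isNegative p)) (trans e (>0⇒¬isNegative q))
  ... | ()

  isNegative-≡⇒same : ∀ {x y} → x ≢ 0ℝ → y ≢ 0ℝ → isNegative x ≡ isNegative y → SameSign x y
  isNegative-≡⇒same x≢0 y≢0 eq with same⊎opposite x≢0 y≢0
  ... | inj₁ x∼y = x∼y
  ... | inj₂ x⊥y = ⊥-elim (isNegative-opposite x⊥y eq)

  opposite⇒a-b∼a : ∀ {a b} → Opposite a b → SameSign (a - b) a
  opposite⇒a-b∼a (inj₁ (a>0 , b<0)) = inj₁ (x<y⇒0<y-x (<-trans b<0 a>0) , a>0)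
  opposite⇒a-b∼a (inj₂ (a<0 , b>0)) = inj₂ (x<y⇒x-y<0 (<-trans a<0 b>0) , a<0)

  opposite⇒-b∼a : ∀ {a b} → Opposite a b → SameSign (- b) a
  opposite⇒-b∼a (inj₁ (a>0 , b<0)) = inj₁ (<0⇒->0 b<0 , a>0)
  opposite⇒-b∼a (inj₂ (a<0 , b>0)) = inj₂ (>0⇒-<0 b>0 , a<0)

  -- τ is the time at which a + s (b - a) vanishes.
  module Crossing {a b : ℝ} (a⊥b : Opposite a b) where

    τ : ℝ
    τ = a * (a - b) ⁻¹

    private
      a-b∼a : SameSign (a - b) a
      a-b∼a = opposite⇒a-b∼a a⊥b

    a-b≢0 : a - b ≢ 0ℝ
    a-b≢0 = same⇒≢0 a-b∼a

    private
      factor : ∀ s → a + s * (b - a) ≡ (a - b) * (τ - s)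
      factor s = begin
        a + s * (b - a)
          ≡⟨ solve 3 (λ a b s → a :+ s :* (b :- a) := a :* con 1ℤ :- (a :- b) :* s) refl a b s ⟩
        a * 1ℝ - (a - b) * s
          ≡⟨ cong (λ z → a * z - (a - b) * s) (*-inverseʳ a-b≢0) ⟨
        a * ((a - b) * (a - b) ⁻¹) - (a - b) * s
          ≡⟨ solve 4 (λ a b w s → a :* ((a :- b) :* w) :- (a :- b) :* s := (a :- b) :* (a :* w :- s))
                   refl a b ((a - b) ⁻¹) s ⟩
        (a - b) * (τ - s) ∎
        where open ≡-Reasoning

    0<τ : 0ℝ <ℝ τ
    0<τ = same⇒0<* (same-sym (same-⁻¹ a-b∼a))

    τ<1 : τ <ℝ 1ℝ
    τ<1 = 0<y-x⇒x<y (<-resp-≡ refl (sym 1-τ) (same⇒0<* (same-trans (opposite⇒-b∼a a⊥b) (same-sym (same-⁻¹ a-b∼a)))))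
      where
      1-τ : 1ℝ - τ ≡ - b * (a - b) ⁻¹
      1-τ = trans (cong (_- τ) (sym (*-inverseʳ a-b≢0)))
                  (solve 3 (λ a b w → (a :- b) :* w :- a :* w := (:- b) :* w) refl a b ((a - b) ⁻¹))

    before : ∀ {s} → s <ℝ τ → SameSign (a + s * (b - a)) a
    before {s} s<τ = subst (λ z → SameSign z a) (sym (factor s)) (same-*ʳ-pos a-b∼a (x<y⇒0<y-x s<τ))

    after : ∀ {s} → τ <ℝ s → SameSign (a + s * (b - a)) b
    after {s} τ<s = subst (λ z → SameSign z b) (sym (factor s))
      (opposite-trans (same-*ʳ-neg a-b∼a (x<y⇒x-y<0 τ<s)) a⊥b)

  -- a b' - a' b = (τ' - τ) (a - b) (a' - b')
  same-crossing⇒det≡0 : ∀ {a b a' b'} (a⊥b : Opposite a b) (a'⊥b' : Opposite a' b') →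
    Crossing.τ a⊥b ≡ Crossing.τ a'⊥b' → a * b' - a' * b ≡ 0ℝ
  same-crossing⇒det≡0 {a} {b} {a'} {b'} a⊥b a'⊥b' τ≡τ' = begin
    a * b' - a' * b
      ≡⟨ solve 6 (λ a b a' b' w w' → a :* b' :- a' :* b :=
           (a' :* w' :- a :* w) :* ((a :- b) :* (a' :- b'))
           :+ a :* (a' :- b') :* ((a :- b) :* w :- con 1ℤ)
           :- a' :* (a :- b) :* ((a' :- b') :* w' :- con 1ℤ)) refl a b a' b' w w' ⟩
    (τ' - τ) * (u * u') + a * u' * (u * w - 1ℝ) - a' * u * (u' * w' - 1ℝ)
      ≡⟨ cong₂ (λ x y → (τ' - τ) * (u * u') + a * u' * (x - 1ℝ) - a' * u * (y - 1ℝ))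
               (*-inverseʳ (Crossing.a-b≢0 a⊥b)) (*-inverseʳ (Crossing.a-b≢0 a'⊥b')) ⟩
    (τ' - τ) * (u * u') + a * u' * (1ℝ - 1ℝ) - a' * u * (1ℝ - 1ℝ)
      ≡⟨ cong (λ x → (x - τ) * (u * u') + a * u' * (1ℝ - 1ℝ) - a' * u * (1ℝ - 1ℝ)) (sym τ≡τ') ⟩
    (τ - τ) * (u * u') + a * u' * (1ℝ - 1ℝ) - a' * u * (1ℝ - 1ℝ)
      ≡⟨ solve 5 (λ t p q r o → (t :- t) :* p :+ q :* (o :- o) :- r :* (o :- o) := con 0ℤ)
               refl τ (u * u') (a * u') (a' * u) 1ℝ ⟩
    0ℝ ∎
    where
    open ≡-Reasoning
    u = a - b
    u' = a' - b'
    w = u ⁻¹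
    w' = u' ⁻¹
    τ = Crossing.τ a⊥b
    τ' = Crossing.τ a'⊥b'

  same-along-segment : ∀ {a b s} → a ≢ 0ℝ → ¬ Opposite a b → 0ℝ <ℝ s → s <ℝ 1ℝ →
    SameSign (a + s * (b - a)) a
  same-along-segment {a} {b} {s} a≢0 a≁b 0<s s<1 =
    subst (λ z → SameSign z a) (sym weights) (with-b (b ≟ℝ 0ℝ))
    where
    weights : a + s * (b - a) ≡ a * (1ℝ - s) + b * s
    weights = solve 3 (λ a b s → a :+ s :* (b :- a) := a :* (con 1ℤ :- s) :+ b :* s) refl a b s
    a-part : SameSign (a * (1ℝ - s)) a
    a-part = same-*ʳ-pos (same-refl a≢0) (x<y⇒0<y-x s<1)
    with-b : Dec (b ≡ 0ℝ) → SameSign (a * (1ℝ - s) + b * s) a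
    with-b (yes refl) = subst (λ z → SameSign z a) (sym (trans (cong (a * (1ℝ - s) +_) (zeroˡ s)) (+-identityʳ _))) a-part
    with-b (no b≢0) with same⊎opposite a≢0 b≢0
    ... | inj₁ a∼b = same-+ a-part (same-*ʳ-pos (same-sym a∼b) 0<s)
    ... | inj₂ a⊥b = ⊥-elim (a≁b a⊥b)

  PreservesSign : ℝ → ℝ → ℝ → Set
  PreservesSign ε a β = ∀ {ε'} → 0ℝ <ℝ ε' → ε' ≤ℝ ε → a ≢ 0ℝ → SameSign (a + ε' * β) a

  preservesSign-antimono : ∀ {ε ε₂ a β} → PreservesSign ε a β → ε₂ ≤ℝ ε → PreservesSign ε₂ a β
  preservesSign-antimono ok ε₂≤ε ε'>0 ε'≤ε₂ = ok ε'>0 (≤-trans ε'≤ε₂ ε₂≤ε)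

  -- For β < 0 the bound ε = a (- β)⁻¹ / 2 keeps ε' (- β) ≤ a / 2 < a.
  small-perturbation-pos : ∀ {a} → 0ℝ <ℝ a → ∀ β →
    Σ ℝ λ ε → 0ℝ <ℝ ε × (∀ {ε'} → 0ℝ <ℝ ε' → ε' ≤ℝ ε → 0ℝ <ℝ a + ε' * β)
  small-perturbation-pos {a} a>0 β with compare β 0ℝ
  ... | tri≈ _ refl _ = 1ℝ , 0<1 , λ {ε'} _ _ →
    <-resp-≡ refl (sym (trans (cong (a +_) (zeroʳ ε')) (+-identityʳ a))) a>0
  ... | tri> _ _ β>0 = 1ℝ , 0<1 , λ ε'>0 _ → +-pos a>0 (*-pos ε'>0 β>0)
  ... | tri< β<0 _ _ = ε , 0<ε , λ {ε'} _ ε'≤ε →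
    <-resp-≡ refl (solve 3 (λ a e b → a :- e :* (:- b) := a :+ e :* b) refl a ε' β)
      (x<y⇒0<y-x (≤-<-trans (≤-trans (*-monoʳ-≤ 0<-β ε'≤ε) (inj₂ ε*-β)) (*½-< a>0)))
    where
    0<-β = <0⇒->0 β<0
    ε = a * (- β) ⁻¹ * ½
    0<ε : 0ℝ <ℝ ε
    0<ε = *-pos (*-pos a>0 (⁻¹-pos 0<-β)) 0<½
    ε*-β : ε * - β ≡ a * ½
    ε*-β = trans (solve 4 (λ a w h m → a :* w :* h :* m := a :* h :* (m :* w)) refl a ((- β) ⁻¹) ½ (- β))
                 (trans (cong (a * ½ *_) (*-inverseʳ (>⇒≢0 0<-β))) (*-identityʳ _))

  small-perturbation : ∀ a β → Σ ℝ λ ε → 0ℝ <ℝ ε × PreservesSign ε a β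
  small-perturbation a β with compare a 0ℝ
  ... | tri≈ _ a≡0 _ = 1ℝ , 0<1 , λ _ _ a≢0 → ⊥-elim (a≢0 a≡0)
  ... | tri> _ _ a>0 with small-perturbation-pos a>0 β
  ...   | ε , ε>0 , ok = ε , ε>0 , λ ε'>0 ε'≤ε _ → inj₁ (ok ε'>0 ε'≤ε , a>0)
  small-perturbation a β | tri< a<0 _ _ with small-perturbation-pos (<0⇒->0 a<0) (- β)
  ...   | ε , ε>0 , ok = ε , ε>0 , λ {ε'} ε'>0 ε'≤ε _ → inj₂ (
    <-resp-≡ (-‿involutive _) -0#≈0#
      (neg-antimono-< (<-resp-≡ refl (solve 3 (λ a e b → :- a :+ e :* (:- b) := :- (a :+ e :* b)) refl a ε' β)
        (ok ε'>0 ε'≤ε))) , a<0)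

  small-perturbation-all : ∀ {A : Set} (xs : List A) (a β : A → ℝ) →
    Σ ℝ λ ε → 0ℝ <ℝ ε × (∀ {x} → x ∈ xs → PreservesSign ε (a x) (β x))
  small-perturbation-all [] a β = 1ℝ , 0<1 , λ ()
  small-perturbation-all (y ∷ xs) a β with small-perturbation-all xs a β | small-perturbation (a y) (β y)
  ... | ε₁ , ε₁>0 , ok₁ | ε₂ , ε₂>0 , ok₂ with lower-bound ε₁>0 ε₂>0
  ...   | ε , ε>0 , ε≤ε₁ , ε≤ε₂ = ε , ε>0 , λ
          { (here refl) → preservesSign-antimono ok₂ ε≤ε₂
          ; (there x∈xs) → preservesSign-antimono (ok₁ x∈xs) ε≤ε₁ }

module LinearForms (R : RealNumbers) where

  open import Data.Nat as ℕ using (ℕ; zero; suc)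
  import Data.Nat.Properties as ℕ
  open import Data.Fin using (Fin; zero; suc)
  open import Data.Integer using (0ℤ; 1ℤ)
  open import Data.Product using (Σ; _×_; _,_; proj₁; proj₂)
  open import Data.List as List using (List; length; map)
  open import Data.List.Properties using (length-map; length-removeAt′)
  open import Data.List.Relation.Unary.Any as Any using (Any; _─_)
  open import Data.List.Relation.Unary.All as All using (All; all?; lookupAny)
  open import Data.List.Relation.Unary.All.Properties using (map⁺; map⁻; ─⁺; ─⁻)
  open import Data.List.Relation.Unary.All.Properties.Core using (¬All⇒Any¬)
  open import Data.Vec.Functional using (Vector; _∷_)
  open import Relation.Nullary using (¬_; yes; no)
  open import Relation.Binary.PropositionalEquality

  open OrderedField R

  ℝ^ : ℕ → Set
  ℝ^ k = Vector ℝ k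

  -- Vectors are functions, so a linear form must also respect pointwise equality.
  record IsLinear {k} (φ : ℝ^ k → ℝ) : Set where
    field
      combination : ∀ x y a b → φ (λ i → a * x i + b * y i) ≡ a * φ x + b * φ y
      pointwise   : ∀ {x y} → (∀ i → x i ≡ y i) → φ x ≡ φ y

    neg : ∀ x → φ (λ i → - x i) ≡ - φ x
    neg x = begin
      φ (λ i → - x i)                  ≡⟨ pointwise (λ i → sym (weights (x i))) ⟩
      φ (λ i → - 1ℝ * x i + 0ℝ * x i)  ≡⟨ combination x x (- 1ℝ) 0ℝ ⟩
      - 1ℝ * φ x + 0ℝ * φ x            ≡⟨ weights (φ x) ⟩
      - φ x                            ∎
      where
      open ≡-Reasoning
      weights : ∀ v → - 1ℝ * v + 0ℝ * v ≡ - v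
      weights v = solve 1 (λ v → :- con 1ℤ :* v :+ con 0ℤ :* v := :- v) refl v

    shift : ∀ x y ε → φ (λ i → x i + ε * y i) ≡ φ x + ε * φ y
    shift x y ε = begin
      φ (λ i → x i + ε * y i)       ≡⟨ pointwise (λ i → cong (_+ ε * y i) (sym (one· (x i)))) ⟩
      φ (λ i → 1ℝ * x i + ε * y i)  ≡⟨ combination x y 1ℝ ε ⟩
      1ℝ * φ x + ε * φ y            ≡⟨ cong (_+ ε * φ y) (one· (φ x)) ⟩
      φ x + ε * φ y                 ∎
      where
      open ≡-Reasoning
      one· : ∀ v → 1ℝ * v ≡ v
      one· v = solve 1 (λ v → con 1ℤ :* v := v) refl v

    segment : ∀ x y s → φ (λ i → x i + s * (y i - x i)) ≡ φ x + s * (φ y - φ x)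
    segment x y s = begin
      φ (λ i → x i + s * (y i - x i))        ≡⟨ pointwise (λ i → weights (x i) (y i)) ⟩
      φ (λ i → (1ℝ - s) * x i + s * y i)     ≡⟨ combination x y (1ℝ - s) s ⟩
      (1ℝ - s) * φ x + s * φ y               ≡⟨ weights (φ x) (φ y) ⟨
      φ x + s * (φ y - φ x)                  ∎
      where
      open ≡-Reasoning
      weights : ∀ u v → u + s * (v - u) ≡ (1ℝ - s) * u + s * v
      weights u v = solve 3 (λ u v s → u :+ s :* (v :- u) := (con 1ℤ :- s) :* u :+ s :* v) refl u v s

  open IsLinear

  coordinate-linear : ∀ {k} (i : Fin k) → IsLinear (λ (x : ℝ^ k) → x i)
  coordinate-linear i = record { combination = λ _ _ _ _ → refl ; pointwise = λ x≗y → x≗y i }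

  difference-linear : ∀ {k} {φ ψ : ℝ^ k → ℝ} → IsLinear φ → IsLinear ψ → IsLinear (λ x → φ x - ψ x)
  difference-linear {φ = φ} {ψ} φ-lin ψ-lin = record
    { combination = λ x y a b → trans (cong₂ _-_ (combination φ-lin x y a b) (combination ψ-lin x y a b))
        (solve 6 (λ a b p q r s → (a :* p :+ b :* q) :- (a :* r :+ b :* s) := a :* (p :- r) :+ b :* (q :- s))
          refl a b (φ x) (φ y) (ψ x) (ψ y))
    ; pointwise = λ x≗y → cong₂ _-_ (pointwise φ-lin x≗y) (pointwise ψ-lin x≗y)
    }

  scale-linear : ∀ {k} {φ : ℝ^ k → ℝ} → IsLinear φ → ∀ p → IsLinear (λ x → φ x * p)
  scale-linear {φ = φ} φ-lin p = record
    { combination = λ x y a b → trans (cong (_* p) (combination φ-lin x y a b))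
        (solve 5 (λ a b u v p → (a :* u :+ b :* v) :* p := a :* (u :* p) :+ b :* (v :* p)) refl a b (φ x) (φ y) p)
    ; pointwise = λ x≗y → cong (_* p) (pointwise φ-lin x≗y)
    }

  sumOver-linear : ∀ {A : Set} {k} (ts : List A) {F : A → ℝ^ k → ℝ} → (∀ t → IsLinear (F t)) →
    IsLinear (λ x → sumOver ts (λ t → F t x))
  sumOver-linear {k = k} ts {F} F-lin = record { combination = sum-combination ts ; pointwise = λ x≗y → sum-pointwise ts x≗y }
    where
    sum-combination : ∀ ts x y a b → sumOver ts (λ t → F t (λ i → a * x i + b * y i)) ≡
                                 a * sumOver ts (λ t → F t x) + b * sumOver ts (λ t → F t y)
    sum-combination List.[]       x y a b = solve 2 (λ a b → con 0ℤ := a :* con 0ℤ :+ b :* con 0ℤ) refl a b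
    sum-combination (t List.∷ ts) x y a b = begin
      F t (λ i → a * x i + b * y i) + sumOver ts (λ t → F t (λ i → a * x i + b * y i))
        ≡⟨ cong₂ _+_ (IsLinear.combination (F-lin t) x y a b) (sum-combination ts x y a b) ⟩
      (a * F t x + b * F t y) + (a * sumOver ts (λ t → F t x) + b * sumOver ts (λ t → F t y))
        ≡⟨ solve 6 (λ a b p q r s → (a :* p :+ b :* q) :+ (a :* r :+ b :* s) := a :* (p :+ r) :+ b :* (q :+ s))
             refl a b (F t x) (F t y) (sumOver ts (λ t → F t x)) (sumOver ts (λ t → F t y)) ⟩
      a * (F t x + sumOver ts (λ t → F t x)) + b * (F t y + sumOver ts (λ t → F t y)) ∎
      where open ≡-Reasoning
    sum-pointwise : ∀ ts {x y : ℝ^ k} → (∀ i → x i ≡ y i) → sumOver ts (λ t → F t x) ≡ sumOver ts (λ t → F t y)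
    sum-pointwise ts x≗y = sumOver-cong ts (λ {t} _ → IsLinear.pointwise (F-lin t) x≗y)

  e₀ : ∀ {k} → ℝ^ (suc k)
  e₀ zero    = 1ℝ
  e₀ (suc i) = 0ℝ

  module Pivot {k} {φ : ℝ^ (suc (suc k)) → ℝ} (φ-lin : IsLinear φ) (φe₀≢0 : φ e₀ ≢ 0ℝ) where

    lift : ℝ^ (suc k) → ℝ^ (suc (suc k))
    lift y = (- (φ (0ℝ ∷ y) * φ e₀ ⁻¹)) ∷ y

    lift-combination : ∀ y₁ y₂ a b i → lift (λ j → a * y₁ j + b * y₂ j) i ≡ a * lift y₁ i + b * lift y₂ i
    lift-combination y₁ y₂ a b zero = begin
      - (φ (0ℝ ∷ (λ j → a * y₁ j + b * y₂ j)) * w)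
        ≡⟨ cong (λ z → - (z * w)) (trans (pointwise φ-lin tails) (combination φ-lin _ _ a b)) ⟩
      - ((a * φ (0ℝ ∷ y₁) + b * φ (0ℝ ∷ y₂)) * w)
        ≡⟨ solve 5 (λ a b p q w → :- ((a :* p :+ b :* q) :* w) := a :* (:- (p :* w)) :+ b :* (:- (q :* w)))
                 refl a b (φ (0ℝ ∷ y₁)) (φ (0ℝ ∷ y₂)) w ⟩
      a * lift y₁ zero + b * lift y₂ zero ∎
      where
      open ≡-Reasoning
      w = φ e₀ ⁻¹
      tails : ∀ i → (0ℝ ∷ (λ j → a * y₁ j + b * y₂ j)) i ≡ a * (0ℝ ∷ y₁) i + b * (0ℝ ∷ y₂) i
      tails zero    = solve 2 (λ a b → con 0ℤ := a :* con 0ℤ :+ b :* con 0ℤ) refl a b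
      tails (suc i) = refl
    lift-combination y₁ y₂ a b (suc i) = refl

    lift-pointwise : ∀ {y y'} → (∀ i → y i ≡ y' i) → ∀ i → lift y i ≡ lift y' i
    lift-pointwise y≗y' zero = cong (λ z → - (z * φ e₀ ⁻¹)) (pointwise φ-lin λ { zero → refl ; (suc i) → y≗y' i })
    lift-pointwise y≗y' (suc i) = y≗y' i

    ∘lift-linear : ∀ {χ} → IsLinear χ → IsLinear (λ y → χ (lift y))
    ∘lift-linear χ-lin = record
      { combination = λ y₁ y₂ a b → trans (pointwise χ-lin (lift-combination y₁ y₂ a b)) (combination χ-lin _ _ a b)
      ; pointwise   = λ y≗y' → pointwise χ-lin (lift-pointwise y≗y')
      }

    φ∘lift≡0 : ∀ y → φ (lift y) ≡ 0ℝ
    φ∘lift≡0 y = begin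
      φ (lift y)                           ≡⟨ pointwise φ-lin decompose ⟩
      φ (λ i → x₀ * e₀ i + 1ℝ * (0ℝ ∷ y) i) ≡⟨ combination φ-lin e₀ (0ℝ ∷ y) x₀ 1ℝ ⟩
      x₀ * φ e₀ + 1ℝ * φ (0ℝ ∷ y)          ≡⟨ solve 4 (λ p w a o → :- (p :* w) :* a :+ o :* p := p :* (o :- a :* w))
                                                     refl (φ (0ℝ ∷ y)) (φ e₀ ⁻¹) (φ e₀) 1ℝ ⟩
      φ (0ℝ ∷ y) * (1ℝ - φ e₀ * φ e₀ ⁻¹)   ≡⟨ cong (λ z → φ (0ℝ ∷ y) * (1ℝ - z)) (*-inverseʳ φe₀≢0) ⟩
      φ (0ℝ ∷ y) * (1ℝ - 1ℝ)               ≡⟨ trans (cong (φ (0ℝ ∷ y) *_) (-‿inverseʳ 1ℝ)) (zeroʳ _) ⟩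
      0ℝ                                   ∎
      where
      open ≡-Reasoning
      x₀ = lift y zero
      decompose : ∀ i → lift y i ≡ x₀ * e₀ i + 1ℝ * (0ℝ ∷ y) i
      decompose zero    = solve 1 (λ x → x := x :* con 1ℤ :+ con 1ℤ :* con 0ℤ) refl x₀
      decompose (suc i) = solve 2 (λ x v → v := x :* con 0ℤ :+ con 1ℤ :* v) refl x₀ (y i)

  NonzeroCommonZero : ∀ {k} → List (ℝ^ k → ℝ) → Set
  NonzeroCommonZero {k} Φ = Σ (ℝ^ k) λ x → (Σ (Fin k) λ i → x i ≢ 0ℝ) × All (λ φ → φ x ≡ 0ℝ) Φ

  nonzero-common-zero : ∀ k (Φ : List (ℝ^ (suc k) → ℝ)) → length Φ ℕ.≤ k → All IsLinear Φ → NonzeroCommonZero Φ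
  nonzero-common-zero k Φ |Φ|≤k Φ-lin with all? (λ φ → φ e₀ ≟ℝ 0ℝ) Φ
  ... | yes vanish = e₀ , (zero , >⇒≢0 0<1) , vanish
  ... | no ¬vanish = eliminate k Φ |Φ|≤k Φ-lin (¬All⇒Any¬ (λ φ → φ e₀ ≟ℝ 0ℝ) Φ ¬vanish)
    where
    eliminate : ∀ k (Φ : List (ℝ^ (suc k) → ℝ)) → length Φ ℕ.≤ k → All IsLinear Φ →
                Any (λ φ → ¬ (φ e₀ ≡ 0ℝ)) Φ → NonzeroCommonZero Φ
    eliminate zero Φ |Φ|≤0 _ p with () ← ℕ.≤-trans (ℕ.≤-reflexive (sym (length-removeAt′ Φ (Any.index p)))) |Φ|≤0
    eliminate (suc k) Φ |Φ|≤k Φ-lin p =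
      P.lift y , (suc i , yi≢0) , ─⁻ p (P.φ∘lift≡0 y) (map⁻ y-zero)
      where
      module P = Pivot (proj₁ (lookupAny Φ-lin p)) (proj₂ (lookupAny Φ-lin p))
      Ψ = map (λ χ y → χ (P.lift y)) (Φ ─ p)
      |Ψ|≤k : length Ψ ℕ.≤ k
      |Ψ|≤k = ℕ.≤-trans (ℕ.≤-reflexive (length-map _ (Φ ─ p)))
                (ℕ.≤-pred (ℕ.≤-trans (ℕ.≤-reflexive (sym (length-removeAt′ Φ (Any.index p)))) |Φ|≤k))
      solution = nonzero-common-zero k Ψ |Ψ|≤k (map⁺ (All.map P.∘lift-linear (─⁺ p Φ-lin)))
      y = proj₁ solution
      i = proj₁ (proj₁ (proj₂ solution))
      yi≢0 = proj₂ (proj₁ (proj₂ solution))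
      y-zero = proj₂ (proj₂ solution)

module SlopeArrangement (R : RealNumbers) (n : ℕ) (Λ : Fin n → RealNumbers.ℝ R)
                        (Λ↑ : StrictlyIncreasing R Λ) where

  open import Data.Bool using (Bool; true; false)
  open import Data.Fin as Fin using (_<_; _<?_)
  import Data.Fin.Properties as Fin
  import Data.Nat as ℕ
  open import Data.Product using (_×_; _,_; proj₁; proj₂)
  open import Data.Product.Properties using (≡-dec)
  open import Data.Sum using (_⊎_; inj₁; inj₂)
  open import Data.List using (List; filter; cartesianProduct; allFin)
  open import Data.List.Relation.Unary.All as All using (All)
  open import Data.List.Relation.Unary.All.Properties using (all-filter)
  open import Data.List.Membership.Propositional using (_∈_)
  open import Data.List.Membership.Propositional.Properties
    using (∈-filter⁺; ∈-cartesianProduct⁺; ∈-allFin)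
  open import Relation.Nullary using (Dec)
  open import Relation.Nullary.Decidable using (_×-dec_)
  open import Relation.Binary.Definitions using (DecidableEquality)
  open import Relation.Binary.PropositionalEquality

  open OrderedField R
  open Signs R
  open LinearForms R

  Triple : Set
  Triple = Fin n × Fin n × Fin n

  _≟ᵗ_ : DecidableEquality Triple
  _≟ᵗ_ = ≡-dec Fin._≟_ (≡-dec Fin._≟_ Fin._≟_)

  Ordered : Triple → Set
  Ordered (i , j , k) = i < j × j < k

  ordered? : ∀ t → Dec (Ordered t)
  ordered? (i , j , k) = (i <? j) ×-dec (j <? k)

  allTriples : List Triple
  allTriples = cartesianProduct (allFin n) (cartesianProduct (allFin n) (allFin n))

  triples : List Triple
  triples = filter ordered? allTriples

  ∈triples⇒ordered : ∀ {t} → t ∈ triples → Ordered t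
  ∈triples⇒ordered = All.lookup (all-filter ordered? allTriples)

  ordered⇒∈triples : ∀ {i j k} → i < j → j < k → (i , j , k) ∈ triples
  ordered⇒∈triples {i} {j} {k} i<j j<k =
    ∈-filter⁺ ordered? (∈-cartesianProduct⁺ (∈-allFin i) (∈-cartesianProduct⁺ (∈-allFin j) (∈-allFin k))) (i<j , j<k)

  Δ : ℝ^ n → Triple → ℝ
  Δ b (i , j , k) = (b i - b j) * (Λ k - Λ j) - (b j - b k) * (Λ j - Λ i)

  Δ-linear : ∀ t → IsLinear (λ b → Δ b t)
  Δ-linear (i , j , k) = record
    { combination = λ x y a b → solve 10 (λ xi xj xk yi yj yk a b α β →
        ((a :* xi :+ b :* yi) :- (a :* xj :+ b :* yj)) :* α :- ((a :* xj :+ b :* yj) :- (a :* xk :+ b :* yk)) :* β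
        := a :* ((xi :- xj) :* α :- (xj :- xk) :* β) :+ b :* ((yi :- yj) :* α :- (yj :- yk) :* β))
        refl (x i) (x j) (x k) (y i) (y j) (y k) a b (Λ k - Λ j) (Λ j - Λ i)
    ; pointwise = λ x≗y → cong₂ (λ p q → p * (Λ k - Λ j) - q * (Λ j - Λ i))
        (cong₂ _-_ (x≗y i) (x≗y j)) (cong₂ _-_ (x≗y j) (x≗y k))
    }

  χ : ℝ^ n → SignAssignment n
  χ b i j k = isNegative (Δ b (i , j , k))

  Chamber : ℝ^ n → Set
  Chamber b = ∀ {t} → t ∈ triples → Δ b t ≢ 0ℝ

  SameChamber : ℝ^ n → ℝ^ n → Set
  SameChamber b c = ∀ {t} → t ∈ triples → SameSign (Δ b t) (Δ c t)

  sameChamber-refl : ∀ {b} → Chamber b → SameChamber b b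
  sameChamber-refl b-ch t∈ = same-refl (b-ch t∈)

  sameChamber-chamber : ∀ {b c} → SameChamber b c → Chamber b
  sameChamber-chamber b∼c t∈ = same⇒≢0 (b∼c t∈)

  sameChamber⇒≈ : ∀ {b c} → SameChamber b c → χ b ≈ χ c
  sameChamber⇒≈ b∼c i j k i<j j<k = isNegative-same (b∼c (ordered⇒∈triples i<j j<k))

  Λ-gap : ∀ {i j} → i < j → 0ℝ <ℝ Λ j - Λ i
  Λ-gap {i} {j} i<j = x<y⇒0<y-x (Λ↑ i j i<j)

  χ-realizes : ∀ {b} → Chamber b → RealizesWith R Λ b (χ b)
  χ-realizes {b} b-ch i j k i<j j<k = neg , nonneg
    where
    A = (b i - b j) * (Λ k - Λ j)
    B = (b j - b k) * (Λ j - Λ i)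
    neg : χ b i j k ≡ true → A <ℝ B
    neg χ≡t = 0<y-x⇒x<y (<-resp-≡ refl (solve 2 (λ a b → :- (a :- b) := b :- a) refl A B)
                                        (<0⇒->0 (isNegative≡true⇒<0 χ≡t)))
    nonneg : χ b i j k ≡ false → B <ℝ A
    nonneg χ≡f = 0<y-x⇒x<y (≮0⇒≢0⇒>0 (isNegative≡false⇒≮0 χ≡f) (b-ch (ordered⇒∈triples i<j j<k)))

  module Realizer {b : ℝ^ n} {σ : SignAssignment n} (b-realizes : RealizesWith R Λ b σ) where

    private
      separated : ∀ {i j k} (i<j : i < j) (j<k : j < k) →
        σ i j k ≡ true × (b i - b j) * (Λ k - Λ j) <ℝ (b j - b k) * (Λ j - Λ i) ⊎
        σ i j k ≡ false × (b j - b k) * (Λ j - Λ i) <ℝ (b i - b j) * (Λ k - Λ j)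
      separated {i} {j} {k} i<j j<k with σ i j k in σ≡
      ... | true  = inj₁ (refl , proj₁ (b-realizes i j k i<j j<k) σ≡)
      ... | false = inj₂ (refl , proj₂ (b-realizes i j k i<j j<k) σ≡)

    chamber : Chamber b
    chamber {i , j , k} t∈ Δ≡0 with separated (proj₁ (∈triples⇒ordered t∈)) (proj₂ (∈triples⇒ordered t∈))
    ... | inj₁ (_ , A<B) = <-irrefl (<-resp-≡ refl (sym (x-y≡0⇒x≡y Δ≡0)) A<B)
    ... | inj₂ (_ , B<A) = <-irrefl (<-resp-≡ refl (x-y≡0⇒x≡y Δ≡0) B<A)

    ≈χ : σ ≈ χ b
    ≈χ i j k i<j j<k with separated i<j j<k
    ... | inj₁ (σ≡t , A<B) = trans σ≡t (sym (<0⇒isNegative (x<y⇒x-y<0 A<B)))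
    ... | inj₂ (σ≡f , B<A) = trans σ≡f (sym (>0⇒¬isNegative (x<y⇒0<y-x B<A)))

  monotone4 : ∀ x₁ x₂ x₃ x₄ → (x₁ ≡ x₃ → x₂ ≡ x₁) → (x₂ ≡ x₄ → x₃ ≡ x₂) → (x₁ ≡ x₄ → x₂ ≡ x₁) →
    Monotone4 x₁ x₂ x₃ x₄
  monotone4 true  true  true  true  _ _ _ = ℕ.z≤n
  monotone4 true  true  true  false _ _ _ = ℕ.s≤s ℕ.z≤n
  monotone4 true  true  false true  _ h _ with () ← h refl
  monotone4 true  true  false false _ _ _ = ℕ.s≤s ℕ.z≤n
  monotone4 true  false true  _     h _ _ with () ← h refl
  monotone4 true  false false true  _ _ h with () ← h refl
  monotone4 true  false false false _ _ _ = ℕ.s≤s ℕ.z≤n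
  monotone4 false true  true  true  _ _ _ = ℕ.s≤s ℕ.z≤n
  monotone4 false true  true  false _ _ h with () ← h refl
  monotone4 false true  false _     h _ _ with () ← h refl
  monotone4 false false true  true  _ _ _ = ℕ.s≤s ℕ.z≤n
  monotone4 false false true  false _ h _ with () ← h refl
  monotone4 false false false true  _ _ _ = ℕ.s≤s ℕ.z≤n
  monotone4 false false false false _ _ _ = ℕ.z≤n

  -- Three-term Grassmann–Plücker relations: for a < b < c < d the triple abd lies in the
  -- positive cone of abc and acd, acd in that of abd and bcd, and abd in that of abc and bcd.
  module _ (e : ℝ^ n) (a b c d : Fin n) where

    plücker₁ : (Λ c - Λ a) * Δ e (a , b , d) ≡ (Λ d - Λ a) * Δ e (a , b , c) + (Λ b - Λ a) * Δ e (a , c , d)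
    plücker₁ = solve 8 (λ ea eb ec ed la lb lc ld →
      (lc :- la) :* ((ea :- eb) :* (ld :- lb) :- (eb :- ed) :* (lb :- la)) :=
      (ld :- la) :* ((ea :- eb) :* (lc :- lb) :- (eb :- ec) :* (lb :- la))
      :+ (lb :- la) :* ((ea :- ec) :* (ld :- lc) :- (ec :- ed) :* (lc :- la)))
      refl (e a) (e b) (e c) (e d) (Λ a) (Λ b) (Λ c) (Λ d)

    plücker₂ : (Λ d - Λ b) * Δ e (a , c , d) ≡ (Λ d - Λ c) * Δ e (a , b , d) + (Λ d - Λ a) * Δ e (b , c , d)
    plücker₂ = solve 8 (λ ea eb ec ed la lb lc ld →
      (ld :- lb) :* ((ea :- ec) :* (ld :- lc) :- (ec :- ed) :* (lc :- la)) :=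
      (ld :- lc) :* ((ea :- eb) :* (ld :- lb) :- (eb :- ed) :* (lb :- la))
      :+ (ld :- la) :* ((eb :- ec) :* (ld :- lc) :- (ec :- ed) :* (lc :- lb)))
      refl (e a) (e b) (e c) (e d) (Λ a) (Λ b) (Λ c) (Λ d)

    plücker₃ : (Λ c - Λ b) * Δ e (a , b , d) ≡ (Λ d - Λ b) * Δ e (a , b , c) + (Λ b - Λ a) * Δ e (b , c , d)
    plücker₃ = solve 8 (λ ea eb ec ed la lb lc ld →
      (lc :- lb) :* ((ea :- eb) :* (ld :- lb) :- (eb :- ed) :* (lb :- la)) :=
      (ld :- lb) :* ((ea :- eb) :* (lc :- lb) :- (eb :- ec) :* (lb :- la))
      :+ (lb :- la) :* ((eb :- ec) :* (ld :- lc) :- (ec :- ed) :* (lc :- lb)))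
      refl (e a) (e b) (e c) (e d) (Λ a) (Λ b) (Λ c) (Λ d)

  χ-signotope : ∀ {e} → Chamber e → IsSignotope (χ e)
  χ-signotope {e} e-ch a b c d a<b b<c c<d = monotone4 _ _ _ _
    (cone (Λ-gap a<c) (Λ-gap a<d) (Λ-gap a<b) (plücker₁ e a b c d) abc acd)
    (cone (Λ-gap b<d) (Λ-gap c<d) (Λ-gap a<d) (plücker₂ e a b c d) abd bcd)
    (cone (Λ-gap b<c) (Λ-gap b<d) (Λ-gap a<b) (plücker₃ e a b c d) abc bcd)
    where
    b<d = Fin.<-trans b<c c<d
    a<c = Fin.<-trans a<b b<c
    a<d = Fin.<-trans a<b b<d
    abc = ordered⇒∈triples a<b b<c
    abd = ordered⇒∈triples a<b b<d
    acd = ordered⇒∈triples a<c c<d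
    bcd = ordered⇒∈triples b<c c<d
    cone : ∀ {α β γ s t u} → 0ℝ <ℝ α → 0ℝ <ℝ β → 0ℝ <ℝ γ →
      α * Δ e t ≡ β * Δ e s + γ * Δ e u → s ∈ triples → u ∈ triples →
      isNegative (Δ e s) ≡ isNegative (Δ e u) → isNegative (Δ e t) ≡ isNegative (Δ e s)
    cone α>0 β>0 γ>0 eq s∈ u∈ s≡u =
      isNegative-same (positive-combination α>0 β>0 γ>0 eq (isNegative-≡⇒same (e-ch s∈) (e-ch u∈) s≡u))

module Walk (R : RealNumbers) (n : ℕ) (Λ : Fin n → RealNumbers.ℝ R)
            (Λ↑ : StrictlyIncreasing R Λ) (d : Fin n → RealNumbers.ℝ R) where

  open import Data.Empty using (⊥-elim)
  open import Data.Integer using (1ℤ)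
  import Data.Fin as Fin
  open import Data.Nat as ℕ using (suc)
  import Data.Nat.Properties as ℕ
  open import Data.Product using (Σ; _×_; _,_; proj₁; proj₂)
  open import Data.Sum using (_⊎_; inj₁; inj₂)
  open import Data.List using (List; []; _∷_; filter; length; map)
  open import Data.List.Relation.Unary.Any using (here; there)
  open import Data.List.Relation.Unary.All as All using (All)
  open import Data.List.Relation.Unary.AllPairs using (AllPairs; []; _∷_)
  open import Data.List.Membership.Propositional using (_∈_)
  open import Data.List.Membership.Propositional.Properties using (∈-filter⁺; ∈-filter⁻; ∉[])
  open import Relation.Nullary using (¬_; Dec; yes; no; ¬?)
  open import Relation.Nullary.Decidable using (_×-dec_; _⊎-dec_)
  open import Relation.Unary using (Decidable)
  open import Relation.Binary.PropositionalEquality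

  open FilterLength
  open OrderedField R
  open Signs R
  open LinearForms R
  open SlopeArrangement R n Λ Λ↑
  open FlipGraph n

  Separates : ℝ^ n → Triple → Set
  Separates c t = Opposite (Δ c t) (Δ d t)

  separates? : ∀ c → Decidable (Separates c)
  separates? c t = ((0ℝ <?ℝ Δ c t) ×-dec (Δ d t <?ℝ 0ℝ)) ⊎-dec ((Δ c t <?ℝ 0ℝ) ×-dec (0ℝ <?ℝ Δ d t))

  separating : ℝ^ n → List Triple
  separating c = filter (separates? c) triples

  separation? : ∀ c → (Σ Triple λ t → t ∈ separating c) ⊎ (∀ {t} → t ∈ triples → ¬ Separates c t)
  separation? c with separating c in eq
  ... | []    = inj₂ λ t∈ t-sep → ∉[] (subst (_ ∈_) eq (∈-filter⁺ (separates? c) t∈ t-sep))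
  ... | t ∷ _ = inj₁ (t , here refl)

  toward : ℝ^ n → ℝ → ℝ^ n
  toward c s m = c m + s * (d m - c m)

  Δ-toward : ∀ c s t → Δ (toward c s) t ≡ Δ c t + s * (Δ d t - Δ c t)
  Δ-toward c s t = IsLinear.segment (Δ-linear t) c d s

  crossing : ℝ^ n → Triple → ℝ
  crossing c t = Δ c t * (Δ c t - Δ d t) ⁻¹

  det : ℝ^ n → Triple → Triple → ℝ
  det c t₁ t₂ = Δ c t₁ * Δ d t₂ - Δ c t₂ * Δ d t₁

  -- The segment from c to d meets no two of the hyperplanes Δ · t = 0 at the same time.
  Generic : ℝ^ n → Set
  Generic c = ∀ {t₁ t₂} → t₁ ∈ triples → t₂ ∈ triples → t₁ ≢ t₂ →
    Δ d t₁ ≢ 0ℝ → Δ d t₂ ≢ 0ℝ → det c t₁ t₂ ≢ 0ℝ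

  record Step (c c' : ℝ^ n) : Set where
    field
      chamber  : Chamber c'
      flipped  : Triple
      flipped∈ : flipped ∈ triples
      crosses  : Opposite (Δ c flipped) (Δ c' flipped)
      arrives  : SameSign (Δ c' flipped) (Δ d flipped)
      keeps    : ∀ {t} → t ∈ triples → t ≢ flipped → SameSign (Δ c' t) (Δ c t)

  data Walk : ℝ^ n → Set where
    arrived : ∀ {c} → (∀ {t} → t ∈ triples → ¬ Separates c t) → Walk c
    _∷_     : ∀ {c c'} → Step c c' → Walk c' → Walk c

  -- Move from c just past the first hyperplane met on the segment towards d.
  module NextStep {c} (c-ch : Chamber c) (c-gen : Generic c) {t₀} (t₀∈ : t₀ ∈ separating c) where

    private
      separating⇒ : ∀ {t} → t ∈ separating c → t ∈ triples × Separates c t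
      separating⇒ = ∈-filter⁻ (separates? c)

    -- Opaque: unfolding these choices makes type checking of the step blow up.
    opaque
      private
        first : Σ Triple λ m → m ∈ separating c × (∀ {t} → t ∈ separating c → crossing c m ≤ℝ crossing c t)
        first = argmin (crossing c) (separating c) t₀∈

      m : Triple
      m = proj₁ first

      m∈ : m ∈ triples
      m∈ = proj₁ (separating⇒ (proj₁ (proj₂ first)))

      m-sep : Separates c m
      m-sep = proj₂ (separating⇒ (proj₁ (proj₂ first)))

      m-first : ∀ {t} → t ∈ triples → Separates c t → t ≢ m → crossing c m <ℝ crossing c t
      m-first t∈ t-sep t≢m with proj₂ (proj₂ first) (∈-filter⁺ (separates? c) t∈ t-sep)
      ... | inj₁ m<t = m<t
      ... | inj₂ m≡t = ⊥-elim (c-gen m∈ t∈ (λ m≡t → t≢m (sym m≡t)) (opposite⇒≢0 m-sep) (opposite⇒≢0 t-sep)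
                                  (same-crossing⇒det≡0 m-sep t-sep m≡t))

    opaque
      private
        others : List Triple
        others = filter (λ t → ¬? (t ≟ᵗ m)) (separating c)

        time : Σ ℝ λ s → crossing c m <ℝ s × s <ℝ 1ℝ × (∀ {t} → t ∈ others → s <ℝ crossing c t)
        time = exists-between others (crossing c) (Crossing.τ<1 m-sep) λ t∈others →
          let t∈sep , t≢m = ∈-filter⁻ (λ t → ¬? (t ≟ᵗ m)) t∈others
          in m-first (proj₁ (separating⇒ t∈sep)) (proj₂ (separating⇒ t∈sep)) t≢m

      s : ℝ
      s = proj₁ time

      m<s : crossing c m <ℝ s
      m<s = proj₁ (proj₂ time)

      s<1 : s <ℝ 1ℝ
      s<1 = proj₁ (proj₂ (proj₂ time))

      s<others : ∀ {t} → t ∈ triples → Separates c t → t ≢ m → s <ℝ crossing c t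
      s<others t∈ t-sep t≢m =
        proj₂ (proj₂ (proj₂ time)) (∈-filter⁺ (λ t → ¬? (t ≟ᵗ m)) (∈-filter⁺ (separates? c) t∈ t-sep) t≢m)

    0<s : 0ℝ <ℝ s
    0<s = <-trans (Crossing.0<τ m-sep) m<s

    c' : ℝ^ n
    c' = toward c s

    classify : ∀ {t} → t ∈ triples →
      (t ≡ m × SameSign (Δ c' t) (Δ d t)) ⊎ (t ≢ m × SameSign (Δ c' t) (Δ c t))
    classify {t} t∈ = by-cases (t ≟ᵗ m) (separates? c t)
      where
      moved : ∀ {x} → SameSign (Δ c t + s * (Δ d t - Δ c t)) x → SameSign (Δ c' t) x
      moved {x} = subst (λ z → SameSign z x) (sym (Δ-toward c s t))
      by-cases : Dec (t ≡ m) → Dec (Separates c t) →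
        (t ≡ m × SameSign (Δ c' t) (Δ d t)) ⊎ (t ≢ m × SameSign (Δ c' t) (Δ c t))
      by-cases (yes refl) _         = inj₁ (refl , moved (Crossing.after m-sep m<s))
      by-cases (no t≢m) (yes t-sep) = inj₂ (t≢m , moved (Crossing.before t-sep (s<others t∈ t-sep t≢m)))
      by-cases (no t≢m) (no ¬t-sep) = inj₂ (t≢m , moved (same-along-segment (c-ch t∈) ¬t-sep 0<s s<1))

    m-arrives : SameSign (Δ c' m) (Δ d m)
    m-arrives with classify m∈
    ... | inj₁ (_ , m∼d) = m∼d
    ... | inj₂ (m≢m , _) = ⊥-elim (m≢m refl)

    c'-chamber : Chamber c'
    c'-chamber t∈ with classify t∈
    ... | inj₁ (_ , t∼d) = same⇒≢0 t∼d
    ... | inj₂ (_ , t∼c) = same⇒≢0 t∼c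

    c'-keeps : ∀ {t} → t ∈ triples → t ≢ m → SameSign (Δ c' t) (Δ c t)
    c'-keeps t∈ t≢m with classify t∈
    ... | inj₁ (t≡m , _) = ⊥-elim (t≢m t≡m)
    ... | inj₂ (_ , t∼c) = t∼c

    next : Step c c'
    next = record
      { chamber  = c'-chamber
      ; flipped  = m
      ; flipped∈ = m∈
      ; crosses  = opposite-sym (same-opposite-trans m-arrives (opposite-sym m-sep))
      ; arrives  = m-arrives
      ; keeps    = c'-keeps
      }

    generic : Generic c'
    generic t₁∈ t₂∈ t₁≢t₂ d₁≢0 d₂≢0 det≡0 =
      *-≢0 (>⇒≢0 (x<y⇒0<y-x s<1)) (c-gen t₁∈ t₂∈ t₁≢t₂ d₁≢0 d₂≢0) (trans (sym scaled) det≡0)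
      where
      scaled : ∀ {t₁ t₂} → det c' t₁ t₂ ≡ (1ℝ - s) * det c t₁ t₂
      scaled {t₁} {t₂} = trans (cong₂ (λ x y → x * Δ d t₂ - y * Δ d t₁) (Δ-toward c s t₁) (Δ-toward c s t₂))
        (solve 5 (λ a₁ a₂ b₁ b₂ s → (a₁ :+ s :* (b₁ :- a₁)) :* b₂ :- (a₂ :+ s :* (b₂ :- a₂)) :* b₁
                                    := (con 1ℤ :- s) :* (a₁ :* b₂ :- a₂ :* b₁))
          refl (Δ c t₁) (Δ c t₂) (Δ d t₁) (Δ d t₂) s)

    fewer : length (separating c') ℕ.< length (separating c)
    fewer = filter-length-strict (separates? c') (separates? c) triples still-separated m∈ m-sep
      (same⇒¬opposite m-arrives)
      where
      still-separated : ∀ {t} → t ∈ triples → Separates c' t → Separates c t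
      still-separated t∈ t-sep with classify t∈
      ... | inj₁ (_ , t∼d) = ⊥-elim (same⇒¬opposite t∼d t-sep)
      ... | inj₂ (_ , t∼c) = same-opposite-trans (same-sym t∼c) t-sep

  walk : ∀ k {c} → Chamber c → Generic c → length (separating c) ℕ.< k → Walk c
  walk (suc k) {c} c-ch c-gen |sep|<k with separation? c
  ... | inj₂ none = arrived none
  ... | inj₁ (_ , t∈) = N.next ∷ walk k (Step.chamber N.next) N.generic
                                     (ℕ.≤-trans N.fewer (ℕ.≤-pred |sep|<k))
    where module N = NextStep c-ch c-gen t∈

  walk-from : ∀ {c} → Chamber c → Generic c → Walk c
  walk-from c-ch c-gen = walk _ c-ch c-gen ℕ.≤-refl

  Between : ℝ^ n → ℝ^ n → Set
  Between c x = ∀ {t} → t ∈ triples → SameSign (Δ x t) (Δ c t) ⊎ SameSign (Δ x t) (Δ d t)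

  Differs : ℝ^ n → ℝ^ n → Set
  Differs c x = Σ Triple λ t → t ∈ triples × Opposite (Δ x t) (Δ c t)

  -- The sign vectors met strictly after c on a walk from c towards d.
  Ahead : ℝ^ n → SignAssignment n → Set
  Ahead c w = Σ (ℝ^ n) λ x → w ≡ χ x × Chamber x × Between c x × Differs c x

  between-refl : ∀ {c} → Chamber c → Between c c
  between-refl c-ch t∈ = inj₁ (sameChamber-refl c-ch t∈)

  differs⇒≉ : ∀ {c x} → Differs c x → ¬ (χ c ≈ χ x)
  differs⇒≉ ((i , j , k) , t∈ , x⊥c) χc≈χx =
    isNegative-opposite x⊥c (sym (χc≈χx i j k (proj₁ (∈triples⇒ordered t∈)) (proj₂ (∈triples⇒ordered t∈))))

  module _ {c c'} (c-ch : Chamber c) (st : Step c c') where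
    open Step st

    step-between : Between c c'
    step-between {t} t∈ with t ≟ᵗ flipped
    ... | yes refl = inj₂ arrives
    ... | no t≢f   = inj₁ (keeps t∈ t≢f)

    between-step : ∀ {x} → Between c' x → Between c x
    between-step {x} x-btw {t} t∈ with x-btw t∈ | t ≟ᵗ flipped
    ... | inj₂ x∼d  | _        = inj₂ x∼d
    ... | inj₁ x∼c' | yes refl = inj₂ (same-trans x∼c' arrives)
    ... | inj₁ x∼c' | no t≢f   = inj₁ (same-trans x∼c' (keeps t∈ t≢f))

    between-step-differs : ∀ {x} → Between c' x → Differs c x
    between-step-differs x-btw with x-btw flipped∈
    ... | inj₁ x∼c' = flipped , flipped∈ , same-opposite-trans x∼c' (opposite-sym crosses)
    ... | inj₂ x∼d  = flipped , flipped∈ ,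
                      same-opposite-trans (same-trans x∼d (same-sym arrives)) (opposite-sym crosses)

    step-flip : Flip (χ c) (χ c')
    step-flip = χ-signotope c-ch , χ-signotope chamber , i , j , k , i<j , j<k ,
                isNegative-opposite crosses , unique
      where
      i = proj₁ flipped
      j = proj₁ (proj₂ flipped)
      k = proj₂ (proj₂ flipped)
      i<j = proj₁ (∈triples⇒ordered flipped∈)
      j<k = proj₂ (∈triples⇒ordered flipped∈)
      unique : ∀ i' j' k' → i' Fin.< j' → j' Fin.< k' → χ c i' j' k' ≢ χ c' i' j' k' →
               i' ≡ i × j' ≡ j × k' ≡ k
      unique i' j' k' i'<j' j'<k' differs with (i' , j' , k') ≟ᵗ flipped
      ... | yes refl = refl , refl , refl
      ... | no t≢f   = ⊥-elim (differs (sym (isNegative-same (keeps (ordered⇒∈triples i'<j' j'<k') t≢f))))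

  endpoint : ∀ {c} → Walk c → ℝ^ n
  endpoint {c} (arrived _) = c
  endpoint (_ ∷ w)         = endpoint w

  endpoint-chamber : ∀ {c} → Chamber c → (w : Walk c) → Chamber (endpoint w)
  endpoint-chamber c-ch (arrived _) = c-ch
  endpoint-chamber _    (st ∷ w)    = endpoint-chamber (Step.chamber st) w

  endpoint-arrived : ∀ {c} (w : Walk c) → ∀ {t} → t ∈ triples → ¬ Separates (endpoint w) t
  endpoint-arrived (arrived none) = none
  endpoint-arrived (_ ∷ w)        = endpoint-arrived w

  endpoint-between : ∀ {c} → Chamber c → (w : Walk c) → Between c (endpoint w)
  endpoint-between c-ch (arrived _) = between-refl c-ch
  endpoint-between c-ch (st ∷ w)    = between-step c-ch st (endpoint-between (Step.chamber st) w)

  endpoint-differs : ∀ {c t} → Chamber c → (w : Walk c) → t ∈ triples → Separates c t → Differs c (endpoint w)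
  endpoint-differs c-ch (arrived none) t∈ t-sep = ⊥-elim (none t∈ t-sep)
  endpoint-differs c-ch (st ∷ w)       _  _     =
    between-step-differs c-ch st (endpoint-between (Step.chamber st) w)

  walk-reach : ∀ {c} → Chamber c → (w : Walk c) → Reach (Ahead c) (χ c) (χ (endpoint w))
  walk-reach c-ch (arrived _) = here ≈-refl
  walk-reach c-ch (_∷_ {c' = c'} st w) =
    step (step-flip c-ch st) (c' , refl , c'-ch , step-between c-ch st , between-step-differs c-ch st (between-refl c'-ch))
         (Reach-map (λ (x , w≡χx , x-ch , x-btw , _) → x , w≡χx , x-ch , between-step c-ch st x-btw , between-step-differs c-ch st x-btw)
                    (walk-reach c'-ch w))
    where c'-ch = Step.chamber st

  vertices : ∀ {c} → Walk c → List (ℝ^ n)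
  vertices {c} (arrived _) = c ∷ []
  vertices {c} (_ ∷ w)     = c ∷ vertices w

  flips : ∀ {c} → Walk c → List Triple
  flips (arrived _) = []
  flips (st ∷ w)    = Step.flipped st ∷ flips w

  |vertices|≡1+|flips| : ∀ {c} (w : Walk c) → length (vertices w) ≡ suc (length (flips w))
  |vertices|≡1+|flips| (arrived _) = refl
  |vertices|≡1+|flips| (_ ∷ w)     = cong suc (|vertices|≡1+|flips| w)

  separating⊆flips : ∀ {c t} (w : Walk c) → t ∈ triples → Separates c t → t ∈ flips w
  separating⊆flips (arrived none) t∈ t-sep = ⊥-elim (none t∈ t-sep)
  separating⊆flips {t = t} (st ∷ w) t∈ t-sep with t ≟ᵗ Step.flipped st
  ... | yes refl = here refl
  ... | no t≢f   = there (separating⊆flips w t∈ (same-opposite-trans (Step.keeps st t∈ t≢f) t-sep))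

  vertices-chamber : ∀ {c} → Chamber c → (w : Walk c) → All Chamber (vertices w)
  vertices-chamber c-ch (arrived _) = c-ch All.∷ All.[]
  vertices-chamber c-ch (st ∷ w)    = c-ch All.∷ vertices-chamber (Step.chamber st) w

  vertices-between : ∀ {c} → Chamber c → (w : Walk c) → All (Between c) (vertices w)
  vertices-between c-ch (arrived _) = between-refl c-ch All.∷ All.[]
  vertices-between c-ch (st ∷ w)    =
    between-refl c-ch All.∷ All.map (between-step c-ch st) (vertices-between (Step.chamber st) w)

  vertices-distinct : ∀ {c} → Chamber c → (w : Walk c) → AllPairs (λ σ τ → ¬ σ ≈ τ) (map χ (vertices w))
  vertices-distinct c-ch (arrived _) = All.[] ∷ []
  vertices-distinct c-ch (st ∷ w)    =
    map⁺ (All.map {P = Between _} (λ x-btw → differs⇒≉ (between-step-differs c-ch st x-btw)) (vertices-between (Step.chamber st) w))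
    ∷ vertices-distinct (Step.chamber st) w
    where open import Data.List.Relation.Unary.All.Properties using (map⁺)

  arrived⇒sameChamber : Chamber d → ∀ {e} → Chamber e → (∀ {t} → t ∈ triples → ¬ Separates e t) → SameChamber e d
  arrived⇒sameChamber d-ch e-ch unsep t∈ with same⊎opposite (e-ch t∈) (d-ch t∈)
  ... | inj₁ e∼d = e∼d
  ... | inj₂ e⊥d = ⊥-elim (unsep t∈ e⊥d)

module Genericity (R : RealNumbers) (n : ℕ) (Λ : Fin n → RealNumbers.ℝ R)
                  (Λ↑ : StrictlyIncreasing R Λ) (d : Fin n → RealNumbers.ℝ R) where

  open import Data.Empty using (⊥-elim)
  open import Data.Integer using (0ℤ; 1ℤ)
  open import Data.Fin as Fin using (_<_)
  import Data.Fin.Properties as Fin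
  open import Data.Product using (Σ; _×_; _,_; proj₁; proj₂)
  open import Data.Sum using (_⊎_; inj₁; inj₂)
  open import Data.List using (List; []; _∷_; cartesianProduct)
  open import Data.List.Relation.Unary.Any using (here; there)
  open import Data.List.Membership.Propositional using (_∈_)
  open import Data.List.Membership.Propositional.Properties using (∈-cartesianProduct⁺; ∈-cartesianProduct⁻)
  open import Relation.Nullary using (¬_; Dec; yes; no)
  open import Relation.Binary.Definitions using (tri<; tri≈; tri>)
  open import Relation.Binary.PropositionalEquality

  open OrderedField R
  open Signs R
  open LinearForms R
  open SlopeArrangement R n Λ Λ↑
  open Walk R n Λ Λ↑ d

  unit : Fin n → ℝ^ n
  unit m x with x Fin.≟ m
  ... | yes _ = 1ℝ
  ... | no _  = 0ℝ

  unit-same : ∀ m → unit m m ≡ 1ℝ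
  unit-same m with m Fin.≟ m
  ... | yes _   = refl
  ... | no m≢m = ⊥-elim (m≢m refl)

  unit-other : ∀ {m x} → x ≢ m → unit m x ≡ 0ℝ
  unit-other {m} {x} x≢m with x Fin.≟ m
  ... | yes x≡m = ⊥-elim (x≢m x≡m)
  ... | no _    = refl

  Occurs : Fin n → Triple → Set
  Occurs m (i , j , k) = m ≡ i ⊎ m ≡ j ⊎ m ≡ k

  private
    Δ-at : ∀ e {i j k a b c} → e i ≡ a → e j ≡ b → e k ≡ c →
      Δ e (i , j , k) ≡ (a - b) * (Λ k - Λ j) - (b - c) * (Λ j - Λ i)
    Δ-at e refl refl refl = refl

  Δ-unit-absent : ∀ {m t} → ¬ Occurs m t → Δ (unit m) t ≡ 0ℝ
  Δ-unit-absent {m} {i , j , k} m∉t = trans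
    (Δ-at (unit m) (unit-other (λ i≡m → m∉t (inj₁ (sym i≡m)))) (unit-other (λ j≡m → m∉t (inj₂ (inj₁ (sym j≡m)))))
                   (unit-other (λ k≡m → m∉t (inj₂ (inj₂ (sym k≡m))))))
    (solve 2 (λ x y → (con 0ℤ :- con 0ℤ) :* x :- (con 0ℤ :- con 0ℤ) :* y := con 0ℤ) refl (Λ k - Λ j) (Λ j - Λ i))

  Δ-unit-present : ∀ {m t} → Ordered t → Occurs m t → Δ (unit m) t ≢ 0ℝ
  Δ-unit-present {t = i , j , k} (i<j , j<k) (inj₁ refl) = >⇒≢0 (<-resp-≡ refl (sym eq) (Λ-gap j<k))
    where
    eq : Δ (unit i) (i , j , k) ≡ Λ k - Λ j
    eq = trans (Δ-at (unit i) (unit-same i) (unit-other (≢-sym (Fin.<⇒≢ i<j)))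
                     (unit-other (≢-sym (Fin.<⇒≢ (Fin.<-trans i<j j<k)))))
               (solve 2 (λ x y → (con 1ℤ :- con 0ℤ) :* x :- (con 0ℤ :- con 0ℤ) :* y := x) refl (Λ k - Λ j) (Λ j - Λ i))
  Δ-unit-present {t = i , j , k} (i<j , j<k) (inj₂ (inj₁ refl)) = <⇒≢0 (<-resp-≡ (sym eq) refl (>0⇒-<0 (+-pos (Λ-gap j<k) (Λ-gap i<j))))
    where
    eq : Δ (unit j) (i , j , k) ≡ - ((Λ k - Λ j) + (Λ j - Λ i))
    eq = trans (Δ-at (unit j) (unit-other (Fin.<⇒≢ i<j)) (unit-same j) (unit-other (≢-sym (Fin.<⇒≢ j<k))))
               (solve 2 (λ x y → (con 0ℤ :- con 1ℤ) :* x :- (con 1ℤ :- con 0ℤ) :* y := :- (x :+ y)) refl (Λ k - Λ j) (Λ j - Λ i))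
  Δ-unit-present {t = i , j , k} (i<j , j<k) (inj₂ (inj₂ refl)) = >⇒≢0 (<-resp-≡ refl (sym eq) (Λ-gap i<j))
    where
    eq : Δ (unit k) (i , j , k) ≡ Λ j - Λ i
    eq = trans (Δ-at (unit k) (unit-other (Fin.<⇒≢ (Fin.<-trans i<j j<k))) (unit-other (Fin.<⇒≢ j<k)) (unit-same k))
               (solve 2 (λ x y → (con 0ℤ :- con 0ℤ) :* x :- (con 0ℤ :- con 1ℤ) :* y := y) refl (Λ k - Λ j) (Λ j - Λ i))

  private
    below-min : ∀ {m i j k} → m < i → Ordered (i , j , k) → ¬ Occurs m (i , j , k)
    below-min m<i _         (inj₁ refl)        = Fin.<-irrefl refl m<i
    below-min m<i (i<j , _) (inj₂ (inj₁ refl)) = Fin.<-irrefl refl (Fin.<-trans m<i i<j)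
    below-min m<i (i<j , j<k) (inj₂ (inj₂ refl)) = Fin.<-irrefl refl (Fin.<-trans m<i (Fin.<-trans i<j j<k))

    above-max : ∀ {m i j k} → k < m → Ordered (i , j , k) → ¬ Occurs m (i , j , k)
    above-max k<m (i<j , j<k) (inj₁ refl)      = Fin.<-irrefl refl (Fin.<-trans (Fin.<-trans i<j j<k) k<m)
    above-max k<m (_ , j<k) (inj₂ (inj₁ refl)) = Fin.<-irrefl refl (Fin.<-trans j<k k<m)
    above-max k<m _         (inj₂ (inj₂ refl)) = Fin.<-irrefl refl k<m

  occurs-in-one : ∀ {t₁ t₂} → Ordered t₁ → Ordered t₂ → t₁ ≢ t₂ →
    Σ (Fin n) λ m → (Occurs m t₁ × ¬ Occurs m t₂) ⊎ (Occurs m t₂ × ¬ Occurs m t₁)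
  occurs-in-one {i₁ , j₁ , k₁} {i₂ , j₂ , k₂} o₁ o₂ t₁≢t₂ with Fin.<-cmp i₁ i₂ | Fin.<-cmp k₁ k₂
  ... | tri< i₁<i₂ _ _ | _ = i₁ , inj₁ (inj₁ refl , below-min i₁<i₂ o₂)
  ... | tri> _ _ i₂<i₁ | _ = i₂ , inj₂ (inj₁ refl , below-min i₂<i₁ o₁)
  ... | tri≈ _ refl _ | tri< k₁<k₂ _ _ = k₂ , inj₂ (inj₂ (inj₂ refl) , above-max k₁<k₂ o₁)
  ... | tri≈ _ refl _ | tri> _ _ k₂<k₁ = k₁ , inj₁ (inj₂ (inj₂ refl) , above-max k₂<k₁ o₂)
  ... | tri≈ _ refl _ | tri≈ _ refl _ = j₁ , inj₁ (inj₂ (inj₁ refl) , middle)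
    where
    middle : ¬ Occurs j₁ (i₁ , j₂ , k₁)
    middle (inj₁ refl)        = Fin.<-irrefl refl (proj₁ o₁)
    middle (inj₂ (inj₁ refl)) = t₁≢t₂ refl
    middle (inj₂ (inj₂ refl)) = Fin.<-irrefl refl (proj₂ o₁)

  det-linear : ∀ t₁ t₂ → IsLinear (λ c → det c t₁ t₂)
  det-linear t₁ t₂ = difference-linear (scale-linear (Δ-linear t₁) (Δ d t₂)) (scale-linear (Δ-linear t₂) (Δ d t₁))

  det-unit≢0 : ∀ {t₁ t₂} → t₁ ∈ triples → t₂ ∈ triples → t₁ ≢ t₂ → Δ d t₁ ≢ 0ℝ → Δ d t₂ ≢ 0ℝ →
    Σ (Fin n) λ m → det (unit m) t₁ t₂ ≢ 0ℝ
  det-unit≢0 {t₁} {t₂} t₁∈ t₂∈ t₁≢t₂ d₁≢0 d₂≢0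
    with occurs-in-one (∈triples⇒ordered t₁∈) (∈triples⇒ordered t₂∈) t₁≢t₂
  ... | m , inj₁ (m∈t₁ , m∉t₂) = m , λ det≡0 →
    *-≢0 (Δ-unit-present (∈triples⇒ordered t₁∈) m∈t₁) d₂≢0 (trans (sym eq) det≡0)
    where
    eq : det (unit m) t₁ t₂ ≡ Δ (unit m) t₁ * Δ d t₂
    eq = trans (cong (λ z → Δ (unit m) t₁ * Δ d t₂ - z * Δ d t₁) (Δ-unit-absent m∉t₂))
               (solve 3 (λ a b c → a :* b :- con 0ℤ :* c := a :* b) refl (Δ (unit m) t₁) (Δ d t₂) (Δ d t₁))
  ... | m , inj₂ (m∈t₂ , m∉t₁) = m , λ det≡0 →
    *-≢0 (Δ-unit-present (∈triples⇒ordered t₂∈) m∈t₂) d₁≢0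
      (trans (sym (-‿involutive _)) (trans (cong -_ (trans (sym eq) det≡0)) -0#≈0#))
    where
    eq : det (unit m) t₁ t₂ ≡ - (Δ (unit m) t₂ * Δ d t₁)
    eq = trans (cong (λ z → z * Δ d t₂ - Δ (unit m) t₂ * Δ d t₁) (Δ-unit-absent m∉t₁))
               (solve 3 (λ a b c → con 0ℤ :* b :- a :* c := :- (a :* c)) refl (Δ (unit m) t₂) (Δ d t₂) (Δ d t₁))

  GenericPair : ℝ^ n → Triple × Triple → Set
  GenericPair c (t₁ , t₂) = t₁ ≢ t₂ → Δ d t₁ ≢ 0ℝ → Δ d t₂ ≢ 0ℝ → det c t₁ t₂ ≢ 0ℝ

  PairsIn : List (Triple × Triple) → Set
  PairsIn P = ∀ {q} → q ∈ P → proj₁ q ∈ triples × proj₂ q ∈ triples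

  -- The push is along a unit vector that tilts det · t₁ t₂, and small enough to keep the chamber
  -- and the pairs that are already generic.
  push-generic : ∀ {P c t₁ t₂} → t₁ ∈ triples → t₂ ∈ triples → Chamber c → (∀ {q} → q ∈ P → GenericPair c q) →
    det c t₁ t₂ ≡ 0ℝ → t₁ ≢ t₂ → Δ d t₁ ≢ 0ℝ → Δ d t₂ ≢ 0ℝ →
    Σ (ℝ^ n) λ c' → SameChamber c' c × det c' t₁ t₂ ≢ 0ℝ × (∀ {q} → q ∈ P → GenericPair c' q)
  push-generic {P} {c} {t₁} {t₂} t₁∈ t₂∈ c-ch P-gen det≡0 t₁≢t₂ d₁≢0 d₂≢0 = c' , c'∼c , new , old
    where
    tilt = det-unit≢0 t₁∈ t₂∈ t₁≢t₂ d₁≢0 d₂≢0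
    u = unit (proj₁ tilt)
    small-Δ = small-perturbation-all triples (Δ c) (Δ u)
    small-det = small-perturbation-all P (λ q → det c (proj₁ q) (proj₂ q)) (λ q → det u (proj₁ q) (proj₂ q))
    bound = lower-bound (proj₁ (proj₂ small-Δ)) (proj₁ (proj₂ small-det))
    ε = proj₁ bound
    0<ε = proj₁ (proj₂ bound)

    c' : ℝ^ n
    c' x = c x + ε * u x

    c'∼c : SameChamber c' c
    c'∼c {t} t∈ = subst (λ z → SameSign z (Δ c t)) (sym (IsLinear.shift (Δ-linear t) c u ε))
      (proj₂ (proj₂ small-Δ) t∈ 0<ε (proj₁ (proj₂ (proj₂ bound))) (c-ch t∈))

    new : det c' t₁ t₂ ≢ 0ℝ
    new det'≡0 = *-≢0 (>⇒≢0 0<ε) (proj₂ tilt) (trans (sym pushed) det'≡0)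
      where
      pushed : det c' t₁ t₂ ≡ ε * det u t₁ t₂
      pushed = trans (IsLinear.shift (det-linear t₁ t₂) c u ε) (trans (cong (_+ ε * det u t₁ t₂) det≡0) (+-identityˡ _))

    old : ∀ {q} → q ∈ P → GenericPair c' q
    old {s₁ , s₂} q∈ s₁≢s₂ e₁≢0 e₂≢0 = same⇒≢0
      (subst (λ z → SameSign z (det c s₁ s₂)) (sym (IsLinear.shift (det-linear s₁ s₂) c u ε))
        (proj₂ (proj₂ small-det) q∈ 0<ε (proj₂ (proj₂ (proj₂ bound))) (P-gen q∈ s₁≢s₂ e₁≢0 e₂≢0)))

  generic-pairs : ∀ P → PairsIn P → ∀ {c} → Chamber c →
    Σ (ℝ^ n) λ c' → SameChamber c' c × (∀ {q} → q ∈ P → GenericPair c' q)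
  generic-pairs [] _ c-ch = _ , sameChamber-refl c-ch , λ ()
  generic-pairs ((t₁ , t₂) ∷ P) P⊆ {c} c-ch with generic-pairs P (λ q∈ → P⊆ (there q∈)) c-ch
  ... | c₁ , c₁∼c , c₁-gen = fix (det c₁ t₁ t₂ ≟ℝ 0ℝ) (t₁ ≟ᵗ t₂) (Δ d t₁ ≟ℝ 0ℝ) (Δ d t₂ ≟ℝ 0ℝ)
    where
    Result = Σ (ℝ^ n) λ c' → SameChamber c' c × (∀ {q} → q ∈ (t₁ , t₂) ∷ P → GenericPair c' q)

    keep : GenericPair c₁ (t₁ , t₂) → Result
    keep new = c₁ , c₁∼c , λ { (here refl) → new ; (there q∈) → c₁-gen q∈ }

    push : det c₁ t₁ t₂ ≡ 0ℝ → t₁ ≢ t₂ → Δ d t₁ ≢ 0ℝ → Δ d t₂ ≢ 0ℝ → Result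
    push det≡0 t₁≢t₂ d₁≢0 d₂≢0 = extend
      (push-generic (proj₁ (P⊆ (here refl))) (proj₂ (P⊆ (here refl))) (sameChamber-chamber c₁∼c) c₁-gen
                    det≡0 t₁≢t₂ d₁≢0 d₂≢0)
      where
      extend : (Σ (ℝ^ n) λ c₂ → SameChamber c₂ c₁ × det c₂ t₁ t₂ ≢ 0ℝ × (∀ {q} → q ∈ P → GenericPair c₂ q)) → Result
      extend (c₂ , c₂∼c₁ , new , old) =
        c₂ , (λ t∈ → same-trans (c₂∼c₁ t∈) (c₁∼c t∈)) , λ { (here refl) → λ _ _ _ → new ; (there q∈) → old q∈ }

    fix : Dec (det c₁ t₁ t₂ ≡ 0ℝ) → Dec (t₁ ≡ t₂) → Dec (Δ d t₁ ≡ 0ℝ) → Dec (Δ d t₂ ≡ 0ℝ) → Result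
    fix (no det≢0)  _           _           _           = keep λ _ _ _ → det≢0
    fix (yes _)     (yes t₁≡t₂) _           _           = keep λ t₁≢t₂ → ⊥-elim (t₁≢t₂ t₁≡t₂)
    fix (yes _)     (no _)      (yes d₁≡0)  _           = keep λ _ d₁≢0 → ⊥-elim (d₁≢0 d₁≡0)
    fix (yes _)     (no _)      (no _)      (yes d₂≡0)  = keep λ _ _ d₂≢0 → ⊥-elim (d₂≢0 d₂≡0)
    fix (yes det≡0) (no t₁≢t₂)  (no d₁≢0)   (no d₂≢0)   = push det≡0 t₁≢t₂ d₁≢0 d₂≢0

  generic-nearby : ∀ {c} → Chamber c → Σ (ℝ^ n) λ c' → SameChamber c' c × Generic c'
  generic-nearby c-ch with generic-pairs (cartesianProduct triples triples) (∈-cartesianProduct⁻ triples triples) c-ch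
  ... | c' , c'∼c , c'-gen = c' , c'∼c , λ t₁∈ t₂∈ → c'-gen (∈-cartesianProduct⁺ t₁∈ t₂∈)

module Height (R : RealNumbers) (n : ℕ) (Λ : Fin n → RealNumbers.ℝ R)
              (Λ↑ : StrictlyIncreasing R Λ) where

  open import Data.Bool using (Bool; true; false)
  open import Data.Empty using (⊥-elim)
  open import Data.Product using (_,_; proj₁; proj₂)
  open import Data.Sum using (inj₁; inj₂)
  open import Data.List.Membership.Propositional using (_∈_)
  open import Relation.Nullary using (¬_; yes; no)
  open import Relation.Binary.PropositionalEquality

  open OrderedField R
  open Signs R
  open LinearForms R
  open SlopeArrangement R n Λ Λ↑

  signed : Bool → ℝ → ℝ
  signed true  y = - y
  signed false y = y

  signed-linear : ∀ {k} b {φ : ℝ^ k → ℝ} → IsLinear φ → IsLinear (λ x → signed b (φ x))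
  signed-linear false φ-lin = φ-lin
  signed-linear true {φ} φ-lin = record
    { combination = λ x y a b → trans (cong -_ (IsLinear.combination φ-lin x y a b))
        (solve 4 (λ a b u v → :- (a :* u :+ b :* v) := a :* (:- u) :+ b :* (:- v)) refl a b (φ x) (φ y))
    ; pointwise = λ x≗y → cong -_ (IsLinear.pointwise φ-lin x≗y)
    }

  -- q evaluated at the vertex of the zonotope Σₜ [- Δ · t , Δ · t] labelled by σ.
  height : ℝ^ n → SignAssignment n → ℝ
  height q σ = sumOver triples (contribution q σ)
    where
    contribution : ℝ^ n → SignAssignment n → Triple → ℝ
    contribution q σ (i , j , k) = signed (σ i j k) (Δ q (i , j , k))

  height-linear : ∀ σ → IsLinear (λ q → height q σ)
  height-linear σ = sumOver-linear triples λ (i , j , k) → signed-linear (σ i j k) (Δ-linear (i , j , k))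

  height-resp-≈ : ∀ q {σ σ'} → σ ≈ σ' → height q σ ≡ height q σ'
  height-resp-≈ q σ≈σ' = sumOver-cong triples λ { {i , j , k} t∈ →
    cong (λ b → signed b (Δ q (i , j , k)))
         (σ≈σ' i j k (proj₁ (∈triples⇒ordered t∈)) (proj₂ (∈triples⇒ordered t∈))) }

  signed-max : ∀ {x y} → SameSign x y → ∀ b → signed b y ≤ℝ signed (isNegative x) y
  signed-max (inj₁ (x>0 , y>0)) true  rewrite >0⇒¬isNegative x>0 = inj₁ (<-trans (>0⇒-<0 y>0) y>0)
  signed-max (inj₁ (x>0 , y>0)) false rewrite >0⇒¬isNegative x>0 = ≤-refl
  signed-max (inj₂ (x<0 , y<0)) true  rewrite <0⇒isNegative x<0 = ≤-refl
  signed-max (inj₂ (x<0 , y<0)) false rewrite <0⇒isNegative x<0 = inj₁ (<-trans y<0 (<0⇒->0 y<0))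

  signed-max-strict : ∀ {x y} → SameSign x y → ∀ b → b ≢ isNegative x → signed b y <ℝ signed (isNegative x) y
  signed-max-strict (inj₁ (x>0 , y>0)) true  _   rewrite >0⇒¬isNegative x>0 = <-trans (>0⇒-<0 y>0) y>0
  signed-max-strict (inj₁ (x>0 , y>0)) false b≢ rewrite >0⇒¬isNegative x>0 = ⊥-elim (b≢ refl)
  signed-max-strict (inj₂ (x<0 , y<0)) true  b≢ rewrite <0⇒isNegative x<0 = ⊥-elim (b≢ refl)
  signed-max-strict (inj₂ (x<0 , y<0)) false _   rewrite <0⇒isNegative x<0 = <-trans y<0 (<0⇒->0 y<0)

  height-increases : ∀ q {c x} → Walk.Between R n Λ Λ↑ q c x → Walk.Differs R n Λ Λ↑ q c x →
    height q (χ c) <ℝ height q (χ x)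
  height-increases q {c} {x} x-btw (t₀ , t₀∈ , x⊥c) = sumOver-mono-< triples weakly t₀∈ strictly
    where
    weakly : ∀ {t} → t ∈ triples → signed (isNegative (Δ c t)) (Δ q t) ≤ℝ signed (isNegative (Δ x t)) (Δ q t)
    weakly {t} t∈ with x-btw t∈
    ... | inj₁ x∼c = inj₂ (cong (λ b → signed b (Δ q t)) (sym (isNegative-same x∼c)))
    ... | inj₂ x∼q = signed-max x∼q (isNegative (Δ c t))
    strictly : signed (isNegative (Δ c t₀)) (Δ q t₀) <ℝ signed (isNegative (Δ x t₀)) (Δ q t₀)
    strictly with x-btw t₀∈
    ... | inj₁ x∼c = ⊥-elim (same⇒¬opposite x∼c x⊥c)
    ... | inj₂ x∼q = signed-max-strict x∼q (isNegative (Δ c t₀)) (λ c≡x → isNegative-opposite x⊥c (sym c≡x))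

  -- x lies in the face of the zonotope on which q is maximal.
  Top : ℝ^ n → ℝ^ n → Set
  Top q x = ∀ {t} → t ∈ triples → Δ q t ≢ 0ℝ → SameSign (Δ x t) (Δ q t)

  private
    signed-0 : ∀ b {y} → y ≡ 0ℝ → signed b y ≡ 0ℝ
    signed-0 true  refl = -0#≈0#
    signed-0 false refl = refl

  height-top-constant : ∀ q {x y} → Top q x → Top q y → height q (χ x) ≡ height q (χ y)
  height-top-constant q {x} {y} x-top y-top = sumOver-cong triples same-term
    where
    same-term : ∀ {t} → t ∈ triples → signed (isNegative (Δ x t)) (Δ q t) ≡ signed (isNegative (Δ y t)) (Δ q t)
    same-term {t} t∈ with Δ q t ≟ℝ 0ℝ
    ... | yes q≡0 = trans (signed-0 (isNegative (Δ x t)) q≡0) (sym (signed-0 (isNegative (Δ y t)) q≡0))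
    ... | no q≢0  = cong (λ b → signed b (Δ q t))
                         (isNegative-same (same-trans (x-top t∈ q≢0) (same-sym (y-top t∈ q≢0))))

  height-top-maximal : ∀ q {a} → Top q a → ∀ σ → height q σ ≤ℝ height q (χ a)
  height-top-maximal q {a} a-top σ = sumOver-mono-≤ triples bounded
    where
    bounded : ∀ {t} → t ∈ triples →
      signed (σ (proj₁ t) (proj₁ (proj₂ t)) (proj₂ (proj₂ t))) (Δ q t) ≤ℝ signed (isNegative (Δ a t)) (Δ q t)
    bounded {t} t∈ with Δ q t ≟ℝ 0ℝ
    ... | yes q≡0 = inj₂ (trans (signed-0 (σ (proj₁ t) (proj₁ (proj₂ t)) (proj₂ (proj₂ t))) q≡0)
                               (sym (signed-0 (isNegative (Δ a t)) q≡0)))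
    ... | no q≢0  = signed-max (a-top t∈ q≢0) (σ (proj₁ t) (proj₁ (proj₂ t)) (proj₂ (proj₂ t)))

  unseparated⇒top : ∀ q {e} → Chamber e → (∀ {t} → t ∈ triples → ¬ Walk.Separates R n Λ Λ↑ q e t) → Top q e
  unseparated⇒top q e-ch unsep t∈ q≢0 with same⊎opposite (e-ch t∈) q≢0
  ... | inj₁ e∼q = e∼q
  ... | inj₂ e⊥q = ⊥-elim (unsep t∈ e⊥q)

module Connectivity (R : RealNumbers) (n : ℕ) (Λ : Fin n → RealNumbers.ℝ R)
                    (Λ↑ : StrictlyIncreasing R Λ) where

  open import Data.Empty using (⊥-elim)
  open import Data.Product using (Σ; _×_; _,_; proj₁; proj₂)
  open import Data.Sum using (inj₁; inj₂)
  open import Data.Nat as ℕ using (zero; suc; _∸_)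
  import Data.Nat.Properties as ℕ
  open import Data.Fin as Fin using (zero; suc)
  import Data.Fin.Properties as Fin
  open import Data.List using (List; []; _∷_; length; map; take)
  open import Data.List.Properties using (length-take; length-map)
  open import Data.List.Relation.Unary.AllPairs using (AllPairs)
  import Data.List.Relation.Unary.AllPairs.Properties as AllPairs
  import Data.List.Relation.Unary.All.Properties as All
  open import Data.List.Membership.Setoid.Properties using (index-injective)
  open import Data.List.Relation.Unary.Any as Any using (Any; here; there)
  open import Data.List.Relation.Unary.All as All using (All; []; _∷_)
  open import Data.List.Membership.Propositional using (_∈_)
  open import Data.List.Membership.Propositional.Properties using (∈-filter⁻)
  open import Relation.Nullary using (¬_)
  open import Relation.Binary.Definitions using (tri<; tri≈; tri>)
  open import Relation.Binary.PropositionalEquality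

  open OrderedField R
  open Signs R
  open LinearForms R
  open SlopeArrangement R n Λ Λ↑
  open FlipGraph n
  open Height R n Λ Λ↑
  module Toward = Walk R n Λ Λ↑
  open Toward using (Ahead; Between; Differs; Separates)

  Avoiding : List (SignAssignment n) → SignAssignment n → Set
  Avoiding X w = IsSignotope w × RealizableWithSlopes R Λ w × ¬ Any (w ≈_) X

  -- A walk towards d from a generic point of the chamber of b.
  record Climb (d b : ℝ^ n) : Set where
    field
      start       : ℝ^ n
      start∼b     : SameChamber start b
      end         : ℝ^ n
      end-chamber : Chamber end
      end-arrived : ∀ {t} → t ∈ triples → ¬ Separates d end t
      end-between : Between d start end
      end-differs : ∀ {t} → t ∈ triples → Separates d start t → Differs d start end
      path        : Reach (Ahead d start) (χ start) (χ end)

  opaque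
    climb : ∀ d {b} → Chamber b → Climb d b
    climb d b-ch with Genericity.generic-nearby R n Λ Λ↑ d b-ch
    ... | c , c∼b , c-gen = record
      { start       = c
      ; start∼b     = c∼b
      ; end         = W.endpoint w
      ; end-chamber = W.endpoint-chamber c-ch w
      ; end-arrived = W.endpoint-arrived w
      ; end-between = W.endpoint-between c-ch w
      ; end-differs = W.endpoint-differs c-ch w
      ; path        = W.walk-reach c-ch w
      }
      where
      module W = Toward d
      c-ch : Chamber c
      c-ch = sameChamber-chamber c∼b
      w : W.Walk c
      w = W.walk-from c-ch c-gen

  module Level (q : ℝ^ n) (X : List (SignAssignment n)) (h : ℝ) (X-level : All (λ x → height q x ≡ h) X) where

    off-level-avoiding : ∀ {x} → Chamber x → height q (χ x) ≢ h → Avoiding X (χ x)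
    off-level-avoiding x-ch x≢h = χ-signotope x-ch , (_ , χ-realizes x-ch) , ∉X X-level
      where
      ∉X : ∀ {X} → All (λ x → height q x ≡ h) X → ¬ Any (χ _ ≈_) X
      ∉X (x≡h ∷ _) (here χ≈x)  = x≢h (trans (height-resp-≈ q χ≈x) x≡h)
      ∉X (_ ∷ X-level) (there ∈X) = ∉X X-level ∈X

    climb-avoiding : ∀ {d b} (cl : Climb d b) → let open Climb cl in
      (∀ {x} → Chamber x → Between d start x → Differs d start x → height q (χ x) ≢ h) →
      Reach (Avoiding X) (χ start) (χ end)
    climb-avoiding cl off = Reach-map
      (λ (x , w≡χx , x-ch , x-btw , x-dif) →
         subst (Avoiding X) (sym w≡χx) (off-level-avoiding x-ch (off x-ch x-btw x-dif)))
      (Climb.path cl)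

    record Ascent (b : ℝ^ n) (σ : SignAssignment n) : Set where
      field
        summit         : ℝ^ n
        summit-chamber : Chamber summit
        summit-top     : Top q summit
        ascent         : Reach (Avoiding X) σ (χ summit)
        summit-above   : (Σ Triple λ t → t ∈ triples × Separates q b t) → height q σ <ℝ height q (χ summit)

    ascend : ∀ {b σ} → RealizesWith R Λ b σ → h ≤ℝ height q σ → Ascent b σ
    ascend {b} {σ} b-real h≤σ = record
      { summit         = C.end
      ; summit-chamber = C.end-chamber
      ; summit-top     = unseparated⇒top q C.end-chamber C.end-arrived
      ; ascent         = Reach-respˡ-≈ σ≈C (climb-avoiding C-climb λ _ x-btw x-dif → >⇒≢ (≤-<-trans h≤σ (above x-btw x-dif)))
      ; summit-above   = λ (t , t∈ , t-sep) →
          above C.end-between (C.end-differs t∈ (same-opposite-trans (C.start∼b t∈) t-sep))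
      }
      where
      C-climb = climb q (Realizer.chamber b-real)
      module C = Climb C-climb

      σ≈C : σ ≈ χ C.start
      σ≈C = ≈-trans (Realizer.≈χ b-real) (≈-sym (sameChamber⇒≈ C.start∼b))

      above : ∀ {x} → Between q C.start x → Differs q C.start x → height q σ <ℝ height q (χ x)
      above x-btw x-dif = <-resp-≡ (height-resp-≈ q (≈-sym σ≈C)) refl (height-increases q x-btw x-dif)

    -- The walk from e₂ towards e₁ stays inside the top face, where the height is constant.
    top-joined : ∀ {e₁ e₂} → Chamber e₁ → Chamber e₂ → Top q e₁ → Top q e₂ → h <ℝ height q (χ e₁) →
      Reach (Avoiding X) (χ e₁) (χ e₂)
    top-joined {e₁} {e₂} e₁-ch e₂-ch e₁-top e₂-top above =
      Reach-respˡ-≈ e₁≈E (Reach-respʳ-≈ (sameChamber⇒≈ E.start∼b) (Reach-sym E-start-avoiding E-path))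
      where
      E-climb = climb e₁ e₂-ch
      module E = Climb E-climb

      e₁≈E : χ e₁ ≈ χ E.end
      e₁≈E = ≈-sym (sameChamber⇒≈ (Toward.arrived⇒sameChamber e₁ e₁-ch E.end-chamber E.end-arrived))

      on-top : ∀ {x} → Between e₁ E.start x → Top q x
      on-top x-btw t∈ q≢0 with x-btw t∈
      ... | inj₁ x∼E  = same-trans x∼E (same-trans (E.start∼b t∈) (e₂-top t∈ q≢0))
      ... | inj₂ x∼e₁ = same-trans x∼e₁ (e₁-top t∈ q≢0)

      E-path : Reach (Avoiding X) (χ E.start) (χ E.end)
      E-path = climb-avoiding E-climb λ _ x-btw _ → >⇒≢ (<-resp-≡ refl (height-top-constant q e₁-top (on-top x-btw)) above)

      E-start-avoiding : Avoiding X (χ E.start)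
      E-start-avoiding = off-level-avoiding (sameChamber-chamber E.start∼b) (>⇒≢ (<-resp-≡ refl
        (trans (height-top-constant q e₁-top e₂-top) (sym (height-resp-≈ q (sameChamber⇒≈ E.start∼b)))) above))

  -- If u lies below the top of q, climbing towards q joins u and any v at least as high through
  -- vertices strictly above the level of X, and the two summits meet inside the top face.
  connect : ∀ q {X u v bu bv} → All (λ x → height q x ≡ height q u) X →
    RealizesWith R Λ bu u → RealizesWith R Λ bv v → Avoiding X v →
    height q u ≤ℝ height q v → (Σ Triple λ t → t ∈ triples × Separates q bu t) → Reach (Avoiding X) u v
  connect q {X} {u} {v} X-level bu-real bv-real v-av u≤v u-below =
    Reach-trans U.ascent (Reach-trans (top-joined U.summit-chamber V.summit-chamber U.summit-top V.summit-top
                                                  (U.summit-above u-below))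
                                      (Reach-sym v-av V.ascent))
    where
    open Level q X (height q u) X-level
    module U = Ascent (ascend bu-real ≤-refl)
    module V = Ascent (ascend bv-real u≤v)

  negate : ℝ^ n → ℝ^ n
  negate p i = - p i

  height-negate : ∀ p σ → height (negate p) σ ≡ - height p σ
  height-negate p σ = IsLinear.neg (height-linear σ) p

  negate-level : ∀ {p X u} → All (λ x → height p x ≡ height p u) X →
    All (λ x → height (negate p) x ≡ height (negate p) u) X
  negate-level {p} {u = u} = All.map λ {x} x≡u →
    trans (height-negate p x) (trans (cong -_ x≡u) (sym (height-negate p u)))

  separated-if-below : ∀ q {b u} σ → RealizesWith R Λ b u → height q u <ℝ height q σ →
    Σ Triple λ t → t ∈ triples × Separates q b t
  separated-if-below q {b} σ b-real u<σ with Toward.separation? q b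
  ... | inj₁ (t , t∈sep) = t , ∈-filter⁻ (Toward.separates? q b) t∈sep
  ... | inj₂ none = ⊥-elim (≤⇒≯ (height-top-maximal q (unseparated⇒top q (Realizer.chamber b-real) none) σ)
                                (<-resp-≡ (height-resp-≈ q (Realizer.≈χ b-real)) refl u<σ))

  record Direction (X : List (SignAssignment n)) (u v : SignAssignment n) (b : ℝ^ n) : Set where
    field
      q         : ℝ^ n
      level     : All (λ x → height q x ≡ height q u) X
      ascending : height q u ≤ℝ height q v
      below-top : Σ Triple λ t → t ∈ triples × Separates q b t

  -- One of p and - p works; the triple t with Δ p t ≢ 0ℝ rules out that u sits on top for both.
  direction : ∀ p {X u v b} → All (λ x → height p x ≡ height p u) X →
    (Σ Triple λ t → t ∈ triples × Δ p t ≢ 0ℝ) → RealizesWith R Λ b u → Direction X u v b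
  direction p {X} {u} {v} {b} X-level (t , t∈ , Δpt≢0) b-real with compare (height p u) (height p v)
  ... | tri< u<v _ _ = record
    { q = p ; level = X-level ; ascending = inj₁ u<v ; below-top = separated-if-below p v b-real u<v }
  ... | tri> _ _ v<u = record
    { q = negate p ; level = negate-level {u = u} X-level ; ascending = inj₁ -u<-v
    ; below-top = separated-if-below (negate p) v b-real -u<-v }
    where
    -u<-v : height (negate p) u <ℝ height (negate p) v
    -u<-v = <-resp-≡ (sym (height-negate p u)) (sym (height-negate p v)) (neg-antimono-< v<u)
  ... | tri≈ _ u≡v _ with Toward.separation? p b
  ...   | inj₁ (s , s∈sep) = record
    { q = p ; level = X-level ; ascending = inj₂ u≡v ; below-top = s , ∈-filter⁻ (Toward.separates? p b) s∈sep }
  ...   | inj₂ none = record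
    { q = negate p ; level = negate-level {u = u} X-level
    ; ascending = inj₂ (trans (height-negate p u) (trans (cong -_ u≡v) (sym (height-negate p v))))
    ; below-top = t , t∈ , subst (Opposite (Δ b t)) (sym (IsLinear.neg (Δ-linear t) p))
                               (same-neg-opposite (unseparated⇒top p (Realizer.chamber b-real) none t∈ Δpt≢0)) }

  fan : ∀ m → Fin (m ∸ 2) → Fin m × Fin m × Fin m
  fan (suc (suc m)) k = zero , suc zero , suc (suc k)

  fan-ordered : ∀ m k → let (i , j , l) = fan m k in i Fin.< j × j Fin.< l
  fan-ordered (suc (suc m)) k = ℕ.s≤s ℕ.z≤n , ℕ.s≤s (ℕ.s≤s ℕ.z≤n)

  fan-injective : ∀ m {k k'} → fan m k ≡ fan m k' → k ≡ k'
  fan-injective (suc (suc m)) refl = refl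

  parabola : ℝ^ n
  parabola i = Λ i * Λ i

  -- Intercepts λᵢ² give the tangents of the parabola y = - x² / 4.
  parabola-positive : ∀ {t} → t ∈ triples → 0ℝ <ℝ Δ parabola t
  parabola-positive {i , j , k} t∈ =
    <-resp-≡ refl (sym factored) (*-pos (Λ-gap i<j) (*-pos (Λ-gap j<k) (Λ-gap (Fin.<-trans i<j j<k))))
    where
    i<j = proj₁ (∈triples⇒ordered t∈)
    j<k = proj₂ (∈triples⇒ordered t∈)
    factored : Δ parabola (i , j , k) ≡ (Λ j - Λ i) * ((Λ k - Λ j) * (Λ k - Λ i))
    factored = solve 3 (λ a b c → (a :* a :- b :* b) :* (c :- b) :- (b :* b :- c :* c) :* (b :- a)
                               := (b :- a) :* ((c :- b) :* (c :- a))) refl (Λ i) (Λ j) (Λ k)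

  -- Walking from the parabola towards its negation flips every triple.
  many-vertices : Σ (List (SignAssignment n)) λ σs → length σs ≡ suc (n ∸ 2) ×
    AllPairs (λ σ τ → ¬ σ ≈ τ) σs × All (λ σ → IsSignotope σ × RealizableWithSlopes R Λ σ) σs
  many-vertices =
    take (suc (n ∸ 2)) (map χ (W.vertices w)) , length-take-vertices , AllPairs.take⁺ _ (W.vertices-distinct c-ch w) ,
    All.take⁺ _ (All.map⁺ (All.map {P = Chamber} (λ x-ch → χ-signotope x-ch , _ , χ-realizes x-ch) (W.vertices-chamber c-ch w)))
    where
    module W = Toward (negate parabola)
    nearby = Genericity.generic-nearby R n Λ Λ↑ (negate parabola) (λ t∈ → >⇒≢0 (parabola-positive t∈))
    c = proj₁ nearby
    c-ch : Chamber c
    c-ch = sameChamber-chamber (proj₁ (proj₂ nearby))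
    w : W.Walk c
    w = W.walk-from c-ch (proj₂ (proj₂ nearby))

    fan-flipped : ∀ k → fan n k ∈ W.flips w
    fan-flipped k = W.separating⊆flips w fan∈ (same-opposite-trans (proj₁ (proj₂ nearby) fan∈)
      (inj₁ (parabola-positive fan∈ , <-resp-≡ (sym (IsLinear.neg (Δ-linear (fan n k)) parabola)) refl
                                                  (>0⇒-<0 (parabola-positive fan∈)))))
      where fan∈ = ordered⇒∈triples (proj₁ (fan-ordered n k)) (proj₂ (fan-ordered n k))

    n-2≤|flips| : n ∸ 2 ℕ.≤ length (W.flips w)
    n-2≤|flips| = Fin.injective⇒≤ {f = λ k → Any.index (fan-flipped k)}
      (λ eq → fan-injective n (index-injective (setoid Triple) (fan-flipped _) (fan-flipped _) eq))

    length-take-vertices : length (take (suc (n ∸ 2)) (map χ (W.vertices w))) ≡ suc (n ∸ 2)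
    length-take-vertices = trans (length-take _ (map χ (W.vertices w))) (ℕ.m≤n⇒m⊓n≡m
      (subst (suc (n ∸ 2) ℕ.≤_) (sym (trans (length-map χ (W.vertices w)) (W.|vertices|≡1+|flips| w)))
             (ℕ.s≤s n-2≤|flips|)))

module AvoidingPaths (R : RealNumbers) (n : ℕ) (Λ : Fin (suc (suc (suc n))) → RealNumbers.ℝ R)
                     (Λ↑ : StrictlyIncreasing R Λ) where

  open import Data.Empty using (⊥-elim)
  open import Data.Integer using (0ℤ)
  import Data.Nat as ℕ
  import Data.Nat.Properties as ℕ
  open import Data.Fin using (zero; suc)
  open import Data.Product using (Σ; _×_; _,_; proj₁; proj₂)
  open import Data.List using (List; []; _∷_; length; map)
  open import Data.List.Properties using (length-map)
  open import Data.List.Membership.Propositional using (_∈_)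
  open import Data.List.Relation.Unary.All as All using (All; []; _∷_)
  open import Data.List.Relation.Unary.All.Properties using (map⁻)
  open import Relation.Binary.PropositionalEquality

  open OrderedField R
  open LinearForms R
  open SlopeArrangement R (suc (suc (suc n))) Λ Λ↑
  open Height R (suc (suc (suc n))) Λ Λ↑
  open Connectivity R (suc (suc (suc n))) Λ Λ↑

  -- A nonzero p with p 0 = p 1 = 0 is off the span of 1 and Λ, on which every Δ vanishes.
  tilted : ∀ {p : ℝ^ (suc (suc (suc n)))} → p zero ≡ 0ℝ → p (suc zero) ≡ 0ℝ →
    (Σ (Fin (suc (suc (suc n)))) λ i → p i ≢ 0ℝ) → Σ Triple λ t → t ∈ triples × Δ p t ≢ 0ℝ
  tilted p0≡0 p1≡0 (zero , p0≢0) = ⊥-elim (p0≢0 p0≡0)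
  tilted p0≡0 p1≡0 (suc zero , p1≢0) = ⊥-elim (p1≢0 p1≡0)
  tilted {p} p0≡0 p1≡0 (m@(suc (suc _)) , pm≢0) =
    (zero , suc zero , m) , ordered⇒∈triples (ℕ.s≤s ℕ.z≤n) (ℕ.s≤s (ℕ.s≤s ℕ.z≤n)) ,
    λ Δ≡0 → *-≢0 pm≢0 (>⇒≢0 (Λ-gap {zero} {suc zero} (ℕ.s≤s ℕ.z≤n))) (trans (sym reduced) Δ≡0)
    where
    reduced : Δ p (zero , suc zero , m) ≡ p m * (Λ (suc zero) - Λ zero)
    reduced = trans (cong₂ (λ a b → (a - b) * (Λ m - Λ (suc zero)) - (b - p m) * (Λ (suc zero) - Λ zero)) p0≡0 p1≡0)
      (solve 3 (λ x α β → (con 0ℤ :- con 0ℤ) :* α :- (con 0ℤ :- x) :* β := x :* β)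
        refl (p m) (Λ m - Λ (suc zero)) (Λ (suc zero) - Λ zero))

  opaque
    levelling-form : ∀ (X : List (SignAssignment (suc (suc (suc n))))) u → length X ℕ.< suc n →
      Σ (ℝ^ (suc (suc (suc n)))) λ p →
        All (λ x → height p x ≡ height p u) X × (Σ Triple λ t → t ∈ triples × Δ p t ≢ 0ℝ)
    levelling-form X u |X|<n with nonzero-common-zero (suc (suc n)) Φ |Φ|≤ Φ-linear
      where
      Φ : List (ℝ^ (suc (suc (suc n))) → ℝ)
      Φ = (λ p → p zero) ∷ (λ p → p (suc zero)) ∷ map (λ x p → height p x - height p u) X

      |Φ|≤ : length Φ ℕ.≤ suc (suc n)
      |Φ|≤ = ℕ.s≤s (ℕ.s≤s (subst (ℕ._≤ n) (sym (length-map _ X)) (ℕ.≤-pred |X|<n)))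

      Φ-linear : All IsLinear Φ
      Φ-linear = coordinate-linear zero ∷ coordinate-linear (suc zero) ∷ linear X
        where
        linear : ∀ X → All IsLinear (map (λ x p → height p x - height p u) X)
        linear []      = []
        linear (x ∷ X) = difference-linear (height-linear x) (height-linear u) ∷ linear X
    ... | p , p≢0 , p0≡0 ∷ p1≡0 ∷ X-zeros = p , All.map x-y≡0⇒x≡y (map⁻ X-zeros) , tilted p0≡0 p1≡0 p≢0

  avoiding-connected : ∀ (X : List (SignAssignment (suc (suc (suc n))))) → length X ℕ.< suc n →
    ∀ {u v} → RealizableWithSlopes R Λ u → Avoiding X v → Reach (Avoiding X) u v
  avoiding-connected X |X|<n {u} {v} (bu , bu-real) v-av@(_ , (_ , bv-real) , _) =
    connect q level bu-real bv-real v-av ascending below-top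
    where
    p = levelling-form X u |X|<n
    open Direction (direction (proj₁ p) {v = v} (proj₁ (proj₂ p)) (proj₂ (proj₂ p)) bu-real)

module Deletion where

  open import Data.Nat using (_<_)
  open import Data.List using (List; length)
  open import Data.List.Relation.Unary.Any using (Any)
  open import Relation.Nullary using (¬_)

  connected-after-removal : ∀ (R : RealNumbers) n (Λ : Fin n → RealNumbers.ℝ R) (Λ↑ : StrictlyIncreasing R Λ) →
    ∀ (X : List (SignAssignment n)) → length X < n ∸ 2 → ∀ u v →
    IsSignotope u → RealizableWithSlopes R Λ u → IsSignotope v → RealizableWithSlopes R Λ v →
    ¬ Any (u ≈_) X → ¬ Any (v ≈_) X → Reach (Connectivity.Avoiding R n Λ Λ↑ X) u v
  connected-after-removal R zero                _ _ _ ()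
  connected-after-removal R (suc zero)          _ _ _ ()
  connected-after-removal R (suc (suc zero))    _ _ _ ()
  -- Reach constrains every vertex but the first.
  connected-after-removal R (suc (suc (suc n))) Λ Λ↑ X |X|<n u v _ u-real v-sig v-real _ v∉X =
    AvoidingPaths.avoiding-connected R n Λ Λ↑ X |X|<n u-real (v-sig , v-real , v∉X)

corollary1 : (R : RealNumbers) (n : ℕ) (Λ : Fin n → RealNumbers.ℝ R) →
    StrictlyIncreasing R Λ →
    IsConnectedInduced (n ∸ 2) (RealizableWithSlopes R Λ)
corollary1 R n Λ Λ↑ = Connectivity.many-vertices R n Λ Λ↑ , Deletion.connected-after-removal R n Λ Λ↑
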